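{- Let $\varphi$ be a basic existential or basic universal sentence of spread $m$ and range $r'$ over a graph language $L$. Let $C,M\notin L$ be distinct unary predicate symbols. Let $G$ be an $L$-interpretation such that $G\models\varphi$, and let $\lambda$ be a layering of $\overline{G}$. Let $r\ge r'$ and $\ell>2r(3m+1)$ be integers. Then for all but at most $6rm$ of the $(\ell,r)$-covers of integers $R$, there exists an $m$-plan $p$ for $R$ such that for each $I\in R$ we have $$G[\lambda^{ -1}(I)],\ C:=\lambda^{ -1}(M_{2r}(I)),\ M:=\lambda^{ -1}(M_r(I))\models\varphi^{(p(I))},$$ where $\varphi^{(p(I))}$ is the $(C,M,p(I))$-variant of $\varphi$.
   Context: A graph language $L$ consists of a binary symbol $e$ (adjacency) and finitely many unary predicate symbols; an $L$-interpretation $G$ is a graph $\overline{G}$ together with a subset of $V(\overline{G})$ for each unary symbol. For $S\subseteq V(\overline{G})$, $G[S]$ is the interpretation on $\overline{G}[S]$ with each unary predicate restricted to $S$; the notation $H,C:=A,M:=B$ means $H$ extended by interpreting $C$ as $A$ and $M$ as $B$. A layering of a graph $H$ is $\lambda:V(H)\to\mathbb{Z}$ with $|\lambda(u)-\lambda(v)|\le1$ for every edge $uv$. $d(x,y)\le r$ abbreviates the first-order formula $(\exists z_0,\ldots,z_r)\,z_0=x\land z_r=y\land\bigwedge_{i=1}^r(z_{i-1}=z_i\lor e(z_{i-1},z_i))$, and $d(x,y)>r$ its negation. An $r$-local formula is a formula $\psi$ with one free variable $x$ all of whose quantifiers are of the form $(\exists y:d(x,y)\le r)$ or $(\forall y:d(x,y)\le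 r)$. A basic existential sentence is $(\exists x_1,\ldots,x_m)\bigwedge_{1\le i<j\le m}d(x_i,x_j)>2r\land\bigwedge_{i=1}^m\psi(x_i)$, and a basic universal sentence is $(\forall x_1,\ldots,x_{m+1})\bigwedge_{1\le i<j\le m+1}d(x_i,x_j)>2r\Rightarrow\bigvee_{i=1}^{m+1}\psi(x_i)$, where in both cases $\psi$ is $r$-local; $m$ is the spread, $r$ the range and $\psi$ the core. For such $\varphi$ (spread $m$, range $r$, core $\psi$) and an integer $0\le k\le m$, the $(C,M,k)$-variant $\varphi^{(k)}$ is $(\exists x_1,\ldots,x_k)\bigwedge_{1\le i<j\le k}d(x_i,x_j)>2r\land\bigwedge_{i=1}^k(C(x_i)\land\psi(x_i))$ if $\varphi$ is basic existential, and $(\forall x_1,\ldots,x_{k+1})\bigl(\bigwedge_{i=1}^{k+1}M(x_i)\land\bigwedge_{1\le i<j\le k+1}d(x_i,x_j)>2r\bigr)\Rightarrow\bigvee_{i=1}^{k+1}\psi(x_i)$ if $\varphi$ is basic universal. For integers $\ell\ge2r+1$ and $n$, the $(\ell,r)$-cover of integers determined by $n$ is the set of all intervals $\{i,i+1,\ldots,i+\ell-1\}$ with $i\equiv n\pmod{\ell-2r}$ (there are exactly $\ell-2r$ distinct $(\ell,r)$-covers). For such an interval $I=\{i,\ldots,i+\ell-1\}$ and an integer $d\ge0$, $M_d(I)=\{i+d,\ldots,i+\ell-d-1\}$. For an integer $m\ge0$, an $m$-plan for a cover $R$ is a function $p:R\to\mathbb{Z}_{\ge0}$ with $\sum_{I\in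 R}p(I)=m$. -}

module Defs where

open import Data.Bool using (Bool; true; false; _∧_; _∨_; not; if_then_else_)
open import Data.Nat as ℕ using (ℕ; zero; suc; _<ᵇ_)
open import Data.Fin using (Fin; zero; suc; toℕ; fromℕ; _↑ˡ_; _↑ʳ_; inject₁; opposite)
open import Data.List using (List; []; _∷_; [_]; map; concatMap; filterᵇ; foldr)
open import Data.Bool.ListAction using (any; all)
open import Data.List.Base using (allFin)
open import Data.Integer as ℤ using (ℤ; +_; _≤ᵇ_)
open import Data.Product using (Σ; _×_; _,_)
open import Relation.Binary.PropositionalEquality using (_≡_)
open import Data.Sum using (_⊎_)
open import Relation.Nullary.Decidable using (⌊_⌋)
import Data.Fin as Fin

-- First-order formulas over a graph language with unary symbols U.
-- De Bruijn variables: Fm U n has n free variables (Fin n), index 0 is the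
-- most recently bound one.

data Fm (U : Set) : ℕ → Set where
  tt ff : ∀ {n} → Fm U n
  _≐_   : ∀ {n} → Fin n → Fin n → Fm U n
  e     : ∀ {n} → Fin n → Fin n → Fm U n
  P     : ∀ {n} → U → Fin n → Fm U n
  ¬′_   : ∀ {n} → Fm U n → Fm U n
  _∧′_ _∨′_ _⇒′_ : ∀ {n} → Fm U n → Fm U n → Fm U n
  ∃′ ∀′ : ∀ {n} → Fm U (suc n) → Fm U n

infix  7 _≐_
infix  6 ¬′_
infixr 5 _∧′_
infixr 4 _∨′_
infixr 3 _⇒′_

ext : ∀ {a b} → (Fin a → Fin b) → Fin (suc a) → Fin (suc b)
ext ρ zero = zero
ext ρ (suc i) = suc (ρ i)

ren : ∀ {U a b} → (Fin a → Fin b) → Fm U a → Fm U b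
ren ρ tt = tt
ren ρ ff = ff
ren ρ (x ≐ y) = ρ x ≐ ρ y
ren ρ (e x y) = e (ρ x) (ρ y)
ren ρ (P u x) = P u (ρ x)
ren ρ (¬′ φ) = ¬′ ren ρ φ
ren ρ (φ ∧′ ψ) = ren ρ φ ∧′ ren ρ ψ
ren ρ (φ ∨′ ψ) = ren ρ φ ∨′ ren ρ ψ
ren ρ (φ ⇒′ ψ) = ren ρ φ ⇒′ ren ρ ψ
ren ρ (∃′ φ) = ∃′ (ren (ext ρ) φ)
ren ρ (∀′ φ) = ∀′ (ren (ext ρ) φ)

mapU : ∀ {U V n} → (U → V) → Fm U n → Fm V n
mapU f tt = tt
mapU f ff = ff
mapU f (x ≐ y) = x ≐ y
mapU f (e x y) = e x y
mapU f (P u x) = P (f u) x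
mapU f (¬′ φ) = ¬′ mapU f φ
mapU f (φ ∧′ ψ) = mapU f φ ∧′ mapU f ψ
mapU f (φ ∨′ ψ) = mapU f φ ∨′ mapU f ψ
mapU f (φ ⇒′ ψ) = mapU f φ ⇒′ mapU f ψ
mapU f (∃′ φ) = ∃′ (mapU f φ)
mapU f (∀′ φ) = ∀′ (mapU f φ)

-- blocks of quantifiers: exN k binds k variables, the first (outermost) one
-- having the largest de Bruijn index
exN allN : ∀ {U n} (k : ℕ) → Fm U (k ℕ.+ n) → Fm U n
exN zero φ = φ
exN (suc k) φ = exN k (∃′ φ)
allN zero φ = φ
allN (suc k) φ = allN k (∀′ φ)

⋀ ⋁ : ∀ {U n} → List (Fm U n) → Fm U n
⋀ = foldr _∧′_ tt
⋁ = foldr _∨′_ ff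

pairs : (m : ℕ) → List (Fin m × Fin m)
pairs m = concatMap (λ i → concatMap (λ j → if toℕ i <ᵇ toℕ j then [ (i , j) ] else [])
                                     (allFin m)) (allFin m)

-- d(x,y) ≤ r :=
--   (∃ z_0 … z_r) z_0 = x ∧ z_r = y ∧ ⋀_{i=1..r} (z_{i-1} = z_i ∨ e(z_{i-1},z_i))
dle : ∀ {U n} → ℕ → Fin n → Fin n → Fm U n
dle {U} {n} r x y =
  exN (suc r) ((z zero ≐ x′) ∧′ ((z (fromℕ r) ≐ y′) ∧′
     ⋀ (map (λ j → (z (inject₁ j) ≐ z (suc j)) ∨′ e (z (inject₁ j)) (z (suc j)))
            (allFin r))))
  where
  z : Fin (suc r) → Fin (suc r ℕ.+ n)   -- z_i (z_0 outermost)
  z i = opposite i ↑ˡ n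
  x′ y′ : Fin (suc r ℕ.+ n)
  x′ = suc r ↑ʳ x
  y′ = suc r ↑ʳ y

-- r-local formulas: one free variable x; all quantifiers are of the form
-- (∃ y : d(x,y) ≤ r) / (∀ y : d(x,y) ≤ r).
-- LFm U n : local formula with n bound variables in scope; variables are
-- Fin (suc n), and x is the outermost one, fromℕ n.

data LFm (U : Set) : ℕ → Set where
  tt ff : ∀ {n} → LFm U n
  _≐_   : ∀ {n} → Fin (suc n) → Fin (suc n) → LFm U n
  e     : ∀ {n} → Fin (suc n) → Fin (suc n) → LFm U n
  P     : ∀ {n} → U → Fin (suc n) → LFm U n
  ¬′_   : ∀ {n} → LFm U n → LFm U n
  _∧′_ _∨′_ _⇒′_ : ∀ {n} → LFm U n → LFm U n → LFm U n
  ∃≤ ∀≤ : ∀ {n} → LFm U (suc n) → LFm U n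

loc : ∀ {U n} → ℕ → LFm U n → Fm U (suc n)
loc r tt = tt
loc r ff = ff
loc r (x ≐ y) = x ≐ y
loc r (e x y) = e x y
loc r (P u x) = P u x
loc r (¬′ φ) = ¬′ loc r φ
loc r (φ ∧′ ψ) = loc r φ ∧′ loc r ψ
loc r (φ ∨′ ψ) = loc r φ ∨′ loc r ψ
loc r (φ ⇒′ ψ) = loc r φ ⇒′ loc r ψ
loc {n = n} r (∃≤ φ) = ∃′ (dle r (fromℕ (suc n)) zero ∧′ loc r φ)
loc {n = n} r (∀≤ φ) = ∀′ (dle r (fromℕ (suc n)) zero ⇒′ loc r φ)

data Kind : Set where
  existential universal : Kind

record Basic (U : Set) : Set where
  field
    kind   : Kind
    spread : ℕ
    range  : ℕ
    core   : LFm U 0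
open Basic public

-- variable x_i (i = 1..k as Fin k) inside a block of k quantifiers
xv : ∀ {k} → Fin k → Fin (k ℕ.+ 0)
xv i = opposite i ↑ˡ 0

coreAt : ∀ {U k} → ℕ → LFm U 0 → Fin k → Fm U (k ℕ.+ 0)
coreAt r ψ i = ren (λ _ → xv i) (loc r ψ)

farApart : ∀ {U} (k r : ℕ) → Fm U (k ℕ.+ 0)
farApart k r = ⋀ (map (λ { (i , j) → ¬′ dle (2 ℕ.* r) (xv i) (xv j) }) (pairs k))

sentence : ∀ {U} → Basic U → Fm U 0
sentence φ with kind φ
... | existential =
  exN (spread φ) (farApart (spread φ) (range φ) ∧′
                  ⋀ (map (coreAt (range φ) (core φ)) (allFin (spread φ))))
... | universal =
  allN (suc (spread φ)) (farApart (suc (spread φ)) (range φ) ⇒′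
                  ⋁ (map (coreAt (range φ) (core φ)) (allFin (suc (spread φ)))))

data Ext (U : Set) : Set where
  old : U → Ext U
  C M : Ext U

variant : ∀ {U} → Basic U → ℕ → Fm (Ext U) 0
variant φ k with kind φ
... | existential =
  exN k (farApart k (range φ) ∧′
         ⋀ (map (λ i → P C (xv i) ∧′ mapU old (coreAt (range φ) (core φ) i)) (allFin k)))
... | universal =
  allN (suc k) ((⋀ (map (λ i → P M (xv i)) (allFin (suc k))) ∧′ farApart (suc k) (range φ)) ⇒′
         ⋁ (map (λ i → mapU old (coreAt (range φ) (core φ) i)) (allFin (suc k))))

-- A structure: vertex set = {v ∈ Fin N | dom v ≡ true}; the relations are
-- only ever evaluated on vertices of the structure.
record Str (U : Set) : Set where
  field
    N    : ℕ
    dom  : Fin N → Bool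
    adj  : Fin N → Fin N → Bool
    pred : U → Fin N → Bool
open Str public

verts : ∀ {U} (S : Str U) → List (Fin (N S))
verts S = filterᵇ (dom S) (allFin (N S))

sat : ∀ {U n} (S : Str U) → (Fin n → Fin (N S)) → Fm U n → Bool
sat S ρ tt = true
sat S ρ ff = false
sat S ρ (x ≐ y) = ⌊ ρ x Fin.≟ ρ y ⌋
sat S ρ (e x y) = adj S (ρ x) (ρ y)
sat S ρ (P u x) = pred S u (ρ x)
sat S ρ (¬′ φ) = not (sat S ρ φ)
sat S ρ (φ ∧′ ψ) = sat S ρ φ ∧ sat S ρ ψ
sat S ρ (φ ∨′ ψ) = sat S ρ φ ∨ sat S ρ ψ
sat S ρ (φ ⇒′ ψ) = not (sat S ρ φ) ∨ sat S ρ ψ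
sat S ρ (∃′ φ) = any (λ v → sat S (λ { zero → v ; (suc i) → ρ i }) φ) (verts S)
sat S ρ (∀′ φ) = all (λ v → sat S (λ { zero → v ; (suc i) → ρ i }) φ) (verts S)

_⊨_ : ∀ {U} → Str U → Fm U 0 → Set
S ⊨ φ = sat S (λ ()) φ ≡ true

record LInterp (k : ℕ) : Set where
  field
    n      : ℕ
    adjG   : Fin n → Fin n → Bool
    sym    : ∀ u v → adjG u v ≡ adjG v u
    irrefl : ∀ v → adjG v v ≡ false
    predG  : Fin k → Fin n → Bool
open LInterp public

asStr : ∀ {k} → LInterp k → Str (Fin k)
asStr G = record { N = n G ; dom = λ _ → true ; adj = adjG G ; pred = predG G }

induced : ∀ {k} (G : LInterp k) → (Fin (n G) → Bool) → Str (Fin k)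
induced G S = record { N = n G ; dom = S
                     ; adj = λ u v → S u ∧ S v ∧ adjG G u v
                     ; pred = λ i v → S v ∧ predG G i v }

-- H, C := A, M := B   (A, B restricted to the vertex set of H)
withCM : ∀ {k} (H : Str (Fin k)) → (Fin (N H) → Bool) → (Fin (N H) → Bool) → Str (Ext (Fin k))
withCM {k} H A B = record { N = N H ; dom = dom H ; adj = adj H ; pred = p }
  where
  p : Ext (Fin k) → Fin (N H) → Bool
  p (old i) v = pred H i v
  p C v = dom H v ∧ A v
  p M v = dom H v ∧ B v

Layering : ∀ {k} (G : LInterp k) → (Fin (n G) → ℤ) → Set
Layering G λ′ = ∀ u v → adjG G u v ≡ true → ℤ.∣ λ′ u ℤ.- λ′ v ∣ ℕ.≤ 1

inRange : ℤ → ℤ → ℤ → Bool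
inRange a b z = (a ≤ᵇ z) ∧ (z ≤ᵇ b)

preimage : ∀ {V : Set} → (V → ℤ) → ℤ → ℤ → V → Bool
preimage λ′ a b v = inRange a b (λ′ v)

-- The (ℓ,r)-covers are indexed by c ∈ {0,…,ℓ-2r-1} (cover determined by c);
-- the intervals of cover c are indexed by t ∈ ℤ: I_t = {i,…,i+ℓ-1} with
-- i = c + t(ℓ-2r).  This indexing is a bijection onto the cover.
start : (ℓ r c : ℕ) → ℤ → ℤ
start ℓ r c t = + c ℤ.+ t ℤ.* + (ℓ ℕ.∸ 2 ℕ.* r)

windowSum : (ℤ → ℕ) → ℤ → ℕ → ℕ
windowSum p a zero = 0
windowSum p a (suc N) = p (a ℤ.+ + N) ℕ.+ windowSum p a N

-- p : R → ℤ≥0 (R indexed by t ∈ ℤ) with Σ_{I ∈ R} p(I) = m; the (infinite)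
-- sum is taken to mean: p is finitely supported and its total is m.
IsPlan : ℕ → (ℤ → ℕ) → Set
IsPlan m p = Σ ℤ λ a → Σ ℕ λ len →
  (∀ t → (t ℤ.< a ⊎ a ℤ.+ + len ℤ.≤ t) → p t ≡ 0) × (windowSum p a len ≡ m)

ivl : (ℓ r c : ℕ) → ℤ → ℤ × ℤ
ivl ℓ r c t = start ℓ r c t , start ℓ r c t ℤ.+ + ℓ ℤ.- ℤ.1ℤ

Md : (ℓ d : ℕ) → ℤ × ℤ → ℤ × ℤ
Md ℓ d (i , _) = i ℤ.+ + d , i ℤ.+ + ℓ ℤ.- + d ℤ.- ℤ.1ℤ

pre : ∀ {V : Set} → (V → ℤ) → ℤ × ℤ → V → Bool
pre λ′ (a , b) = preimage λ′ a b

-- The intervals of an (ℓ,r)-cover overlap in 2r layers, so every layer x lies in exactly one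
-- "block" [start t, start t + ℓ − 2r) and, if its offset in that block is at least 2r, in
-- M_{2r}(I_t).  A vertex v at such a layer has its whole r-neighbourhood inside λ⁻¹(I_t), so by
-- locality the core ψ and the distances d ≤ 2r′ are evaluated at v alike in G[λ⁻¹(I_t)] and in
-- G.  Each vertex makes only 2r covers (6r in the shifted test of the universal case) fail this,
-- which is where the 6rm exceptional covers come from.
--
-- Existential case: take m witnesses of φ and let p(I_t) count the witnesses in block t.
-- Universal case: take a longest list X of pairwise far vertices failing ψ; it has at most m
-- elements since G ⊨ φ, and by maximality every vertex failing ψ is within 2r′ of X, hence in the
-- interior of its block once the covers bad for X are excluded.  Let p(I_t) = |X ∩ block t|,
-- with the remaining m − |X| put on one interval.  If G[λ⁻¹(I_t)] had p(I_t) + 1 far apart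
-- vertices in M_r(I_t) failing ψ, they would all lie in block t, and exchanging them for
-- X ∩ block t would give a longer list than X.

module Submission where

open import Defs renaming (sym to adj-sym)
open import Data.Bool using (Bool; true; false; _∧_; _∨_; not; T?; if_then_else_)
open import Data.Bool.ListAction using (any; all)
open import Data.Bool.Properties using (not-¬; ¬-not; T-≡)
open import Data.Empty using (⊥; ⊥-elim)
open import Data.Fin using (Fin; zero; suc; toℕ; fromℕ; _↑ˡ_; _↑ʳ_; inject₁; inject≤; opposite)
import Data.Fin as Fin
open import Data.Fin.Properties using (opposite-involutive; toℕ-inject≤)
open import Data.Integer as ℤ using (ℤ; +_)
open import Data.List using (List; []; _∷_; [_]; map; concatMap; filterᵇ; length; lookup; tabulate; _++_; allFin; downFrom)
open import Data.List.Membership.Propositional using (_∈_; _∉_)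
open import Data.List.Membership.Propositional.Properties
  using (∈-allFin; ∈-concatMap⁺; ∈-concatMap⁻; ∈-lookup; ∈-map⁺; ∈-map⁻; ∈-tabulate⁻)
open import Data.List.Properties using (length-++; length-map; length-tabulate; length-downFrom)
open import Data.List.Relation.Unary.All as All using (All; []; _∷_)
import Data.List.Relation.Unary.All.Properties as All
open import Data.List.Relation.Unary.AllPairs using (AllPairs; []; _∷_; allPairs?)
import Data.List.Relation.Unary.AllPairs.Properties as AllPairs
open import Data.List.Relation.Unary.Any as Any using (Any; here; there)
open import Data.Nat as ℕ using (ℕ; zero; suc; z≤n; s≤s)
import Data.Nat.Properties as ℕ
open import Data.Product using (Σ; _×_; _,_; proj₁; proj₂; map₁)
open import Data.Sum using (_⊎_; inj₁; inj₂)
open import Data.Vec.Functional using () renaming (_∷_ to _∷ᵥ_; [] to []ᵥ)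
open import Function using (Equivalence; id; _∘_)
open import Relation.Binary.PropositionalEquality
  using (_≡_; _≢_; refl; sym; trans; cong; cong₂; subst; subst₂; module ≡-Reasoning)
open import Relation.Nullary using (Dec; yes; no; ¬_)
open import Relation.Nullary.Decidable using (⌊_⌋; _×-dec_)

∧-true⁻ˡ : ∀ {a b} → a ∧ b ≡ true → a ≡ true
∧-true⁻ˡ {true} _ = refl

∧-true⁻ʳ : ∀ {a b} → a ∧ b ≡ true → b ≡ true
∧-true⁻ʳ {true} p = p

∧-true⁺ : ∀ {a b} → a ≡ true → b ≡ true → a ∧ b ≡ true
∧-true⁺ refl refl = refl

∨-true⁻ : ∀ {a b} → a ∨ b ≡ true → a ≡ true ⊎ b ≡ true
∨-true⁻ {true} _ = inj₁ refl
∨-true⁻ {false} p = inj₂ p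

∨-true⁺ˡ : ∀ {a b} → a ≡ true → a ∨ b ≡ true
∨-true⁺ˡ refl = refl

∨-true⁺ʳ : ∀ {a b} → b ≡ true → a ∨ b ≡ true
∨-true⁺ʳ {true} _ = refl
∨-true⁺ʳ {false} p = p

not-true⁻ : ∀ {a} → not a ≡ true → a ≡ false
not-true⁻ {false} _ = refl

not-true⁺ : ∀ {a} → a ≡ false → not a ≡ true
not-true⁺ refl = refl

≡true-ext : ∀ {a b} → (a ≡ true → b ≡ true) → (b ≡ true → a ≡ true) → a ≡ b
≡true-ext {false} {false} _ _ = refl
≡true-ext {false} {true} _ g = g refl
≡true-ext {true} {false} f _ = sym (f refl)
≡true-ext {true} {true} _ _ = refl

⌊≟⌋-true⁻ : ∀ {k} {u v : Fin k} → ⌊ u Fin.≟ v ⌋ ≡ true → u ≡ v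
⌊≟⌋-true⁻ {u = u} {v} p with u Fin.≟ v
... | yes q = q

⌊≟⌋-refl : ∀ {k} (u : Fin k) → ⌊ u Fin.≟ u ⌋ ≡ true
⌊≟⌋-refl u with u Fin.≟ u
... | yes _ = refl
... | no q = ⊥-elim (q refl)

⌊⌋-true⁻ : ∀ {P : Set} (d : Dec P) → ⌊ d ⌋ ≡ true → P
⌊⌋-true⁻ (yes p) _ = p

⌊⌋-false⁻ : ∀ {P : Set} (d : Dec P) → ⌊ d ⌋ ≡ false → ¬ P
⌊⌋-false⁻ (no ¬p) _ = ¬p

module _ {A : Set} where

  any-cong : (f g : A → Bool) → (∀ x → f x ≡ g x) → ∀ xs → any f xs ≡ any g xs
  any-cong f g f≗g [] = refl
  any-cong f g f≗g (x ∷ xs) = cong₂ _∨_ (f≗g x) (any-cong f g f≗g xs)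

  all-cong : (f g : A → Bool) → (∀ x → f x ≡ g x) → ∀ xs → all f xs ≡ all g xs
  all-cong f g f≗g [] = refl
  all-cong f g f≗g (x ∷ xs) = cong₂ _∧_ (f≗g x) (all-cong f g f≗g xs)

  any-true⁻ : ∀ (f : A → Bool) xs → any f xs ≡ true → Σ A λ x → x ∈ xs × f x ≡ true
  any-true⁻ f (x ∷ xs) p with ∨-true⁻ {f x} p
  ... | inj₁ fx = x , here refl , fx
  ... | inj₂ q with any-true⁻ f xs q
  ... | y , y∈ , fy = y , there y∈ , fy

  any-true⁺ : ∀ (f : A → Bool) {x} xs → x ∈ xs → f x ≡ true → any f xs ≡ true
  any-true⁺ f (y ∷ xs) (here refl) fx = ∨-true⁺ˡ fx
  any-true⁺ f (y ∷ xs) (there x∈) fx = ∨-true⁺ʳ {f y} (any-true⁺ f xs x∈ fx)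

  any-false⁻ : ∀ (f : A → Bool) xs {x} → any f xs ≡ false → x ∈ xs → f x ≡ false
  any-false⁻ f (y ∷ xs) p (here refl) with f y
  ... | false = refl
  any-false⁻ f (y ∷ xs) p (there x∈) with f y
  ... | false = any-false⁻ f xs p x∈

  all-true⁻ : ∀ (f : A → Bool) {x} xs → all f xs ≡ true → x ∈ xs → f x ≡ true
  all-true⁻ f (y ∷ xs) p (here refl) = ∧-true⁻ˡ p
  all-true⁻ f (y ∷ xs) p (there x∈) = all-true⁻ f xs (∧-true⁻ʳ {f y} p) x∈

  all-true⁺ : ∀ (f : A → Bool) xs → (∀ x → x ∈ xs → f x ≡ true) → all f xs ≡ true
  all-true⁺ f [] _ = refl
  all-true⁺ f (x ∷ xs) h = ∧-true⁺ (h x (here refl)) (all-true⁺ f xs λ y y∈ → h y (there y∈))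

  ∈-filterᵇ⁻ : ∀ (d : A → Bool) {x} xs → x ∈ filterᵇ d xs → x ∈ xs × d x ≡ true
  ∈-filterᵇ⁻ d (y ∷ xs) x∈ with d y in eq
  ∈-filterᵇ⁻ d (y ∷ xs) (here refl) | true = here refl , eq
  ∈-filterᵇ⁻ d (y ∷ xs) (there x∈) | true = map₁ there (∈-filterᵇ⁻ d xs x∈)
  ... | false = map₁ there (∈-filterᵇ⁻ d xs x∈)

  ∈-filterᵇ⁺ : ∀ (d : A → Bool) {x} xs → x ∈ xs → d x ≡ true → x ∈ filterᵇ d xs
  ∈-filterᵇ⁺ d (y ∷ xs) (here refl) dx with d y
  ∈-filterᵇ⁺ d (y ∷ xs) (here refl) refl | true = here refl
  ∈-filterᵇ⁺ d (y ∷ xs) (there x∈) dx with d y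
  ... | true = there (∈-filterᵇ⁺ d xs x∈ dx)
  ... | false = ∈-filterᵇ⁺ d xs x∈ dx

  any-filterᵇ : ∀ (d f : A → Bool) → (∀ x → d x ≡ false → f x ≡ false) → ∀ xs → any f (filterᵇ d xs) ≡ any f xs
  any-filterᵇ d f h [] = refl
  any-filterᵇ d f h (x ∷ xs) with d x in dx
  ... | true = cong (f x ∨_) (any-filterᵇ d f h xs)
  ... | false rewrite h x dx = any-filterᵇ d f h xs

  all-filterᵇ : ∀ (d f : A → Bool) → (∀ x → d x ≡ false → f x ≡ true) → ∀ xs → all f (filterᵇ d xs) ≡ all f xs
  all-filterᵇ d f h [] = refl
  all-filterᵇ d f h (x ∷ xs) with d x in dx
  ... | true = cong (f x ∧_) (all-filterᵇ d f h xs)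
  ... | false rewrite h x dx = all-filterᵇ d f h xs

  length-filterᵇ-not : ∀ (f : A → Bool) xs →
    length (filterᵇ f xs) ℕ.+ length (filterᵇ (λ v → not (f v)) xs) ≡ length xs
  length-filterᵇ-not f [] = refl
  length-filterᵇ-not f (x ∷ xs) with f x
  ... | true = cong suc (length-filterᵇ-not f xs)
  ... | false = trans (ℕ.+-suc _ _) (cong suc (length-filterᵇ-not f xs))

  length-concatMap-const : ∀ {B : Set} (f : A → List B) w → (∀ x → length (f x) ≡ w) →
    ∀ xs → length (concatMap f xs) ≡ length xs ℕ.* w
  length-concatMap-const f w h [] = refl
  length-concatMap-const f w h (x ∷ xs) =
    trans (length-++ (f x)) (cong₂ ℕ._+_ (h x) (length-concatMap-const f w h xs))

  AllPairs-lookup : ∀ {R : A → A → Set} {xs : List A} → AllPairs R xs →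
    ∀ (i j : Fin (length xs)) → toℕ i ℕ.< toℕ j → R (lookup xs i) (lookup xs j)
  AllPairs-lookup {xs = x ∷ xs} (h ∷ _) zero (suc j) _ = All.lookup h (∈-lookup j)
  AllPairs-lookup {xs = x ∷ xs} (_ ∷ t) (suc i) (suc j) (s≤s lt) = AllPairs-lookup t i j lt

module Longest {A : Set} (elems : List A) (complete : ∀ x → x ∈ elems) where

  listsOfLength : ℕ → List (List A)
  listsOfLength zero = [] ∷ []
  listsOfLength (suc j) = concatMap (λ x → map (x ∷_) (listsOfLength j)) elems

  ∈-listsOfLength : ∀ Y → Y ∈ listsOfLength (length Y)
  ∈-listsOfLength [] = here refl
  ∈-listsOfLength (y ∷ Y) =
    ∈-concatMap⁺ _ (Any.map (λ { refl → ∈-map⁺ (y ∷_) (∈-listsOfLength Y) }) (complete y))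

  listsOfLength-length : ∀ j Y → Y ∈ listsOfLength j → length Y ≡ j
  listsOfLength-length zero .[] (here refl) = refl
  listsOfLength-length (suc j) Y Y∈ = heads elems (∈-concatMap⁻ _ {xs = elems} Y∈)
    where
    heads : ∀ xs → Any (λ x → Y ∈ map (x ∷_) (listsOfLength j)) xs → length Y ≡ suc j
    heads (x ∷ xs) (here p) with ∈-map⁻ (x ∷_) p
    ... | Y′ , Y′∈ , refl = cong suc (listsOfLength-length j Y′ Y′∈)
    heads (x ∷ xs) (there p) = heads xs p

  Longest : (List A → Set) → ℕ → List A → Set
  Longest Q b X = Q X × length X ℕ.≤ b × (∀ Y → Q Y → length Y ℕ.≤ b → length Y ℕ.≤ length X)

  longest : ∀ {Q : List A → Set} → (∀ Y → Dec (Q Y)) → Q [] → ∀ b → Σ (List A) (Longest Q b)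
  longest Q? Q[] zero = [] , Q[] , z≤n , λ _ _ Y≤0 → Y≤0
  longest {Q} Q? Q[] (suc b) with any (λ Y → ⌊ Q? Y ⌋) (listsOfLength (suc b)) in found
  ... | true with any-true⁻ _ (listsOfLength (suc b)) found
  ... | X , X∈ , QX = X , ⌊⌋-true⁻ (Q? X) QX , ℕ.≤-reflexive (listsOfLength-length (suc b) X X∈) ,
                      λ Y _ Y≤ → subst (length Y ℕ.≤_) (sym (listsOfLength-length (suc b) X X∈)) Y≤
  longest {Q} Q? Q[] (suc b) | false with longest Q? Q[] b
  ... | X , QX , X≤b , X-longest = X , QX , ℕ.m≤n⇒m≤1+n X≤b , λ Y QY Y≤ → shorter Y QY (ℕ.m≤n⇒m<n∨m≡n Y≤)
    where
    shorter : ∀ Y → Q Y → length Y ℕ.< suc b ⊎ length Y ≡ suc b → length Y ℕ.≤ length X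
    shorter Y QY (inj₁ Y<) = X-longest Y QY (ℕ.≤-pred Y<)
    shorter Y QY (inj₂ Y≡) = ⊥-elim (⌊⌋-false⁻ (Q? Y)
      (any-false⁻ _ (listsOfLength (suc b)) found (subst (λ j → Y ∈ listsOfLength j) Y≡ (∈-listsOfLength Y))) QY)

-- σ ++ᵉ ρ interprets the k variables bound by exN k / allN k by σ (in order of binding
-- from the innermost) and the remaining free variables by ρ.
_++ᵉ_ : ∀ {V : Set} {k n} → (Fin k → V) → (Fin n → V) → Fin (k ℕ.+ n) → V
_++ᵉ_ {k = zero} σ ρ = ρ
_++ᵉ_ {k = suc k} σ ρ = σ zero ∷ᵥ ((λ j → σ (suc j)) ++ᵉ ρ)

++ᵉ-↑ˡ : ∀ {V : Set} {k n} (σ : Fin k → V) (ρ : Fin n → V) i → (σ ++ᵉ ρ) (i ↑ˡ n) ≡ σ i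
++ᵉ-↑ˡ {k = suc k} σ ρ zero = refl
++ᵉ-↑ˡ {k = suc k} σ ρ (suc i) = ++ᵉ-↑ˡ (λ j → σ (suc j)) ρ i

++ᵉ-↑ʳ : ∀ {V : Set} {k n} (σ : Fin k → V) (ρ : Fin n → V) i → (σ ++ᵉ ρ) (k ↑ʳ i) ≡ ρ i
++ᵉ-↑ʳ {k = zero} σ ρ i = refl
++ᵉ-↑ʳ {k = suc k} σ ρ i = ++ᵉ-↑ʳ (λ j → σ (suc j)) ρ i

++ᵉ-xv : ∀ {V : Set} {k} (σ : Fin k → V) (ρ : Fin 0 → V) i → (σ ++ᵉ ρ) (xv i) ≡ σ (opposite i)
++ᵉ-xv σ ρ i = ++ᵉ-↑ˡ σ ρ (opposite i)

pairsFrom : ∀ {m} → Fin m → Fin m → List (Fin m × Fin m)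
pairsFrom i j = if toℕ i ℕ.<ᵇ toℕ j then [ (i , j) ] else []

∈-pairs : ∀ {m} (i j : Fin m) → toℕ i ℕ.< toℕ j → (i , j) ∈ pairs m
∈-pairs {m} i j i<j = ∈-concatMap⁺ _ (rows (allFin m) (∈-allFin i))
  where
  here-pair : (i , j) ∈ pairsFrom i j
  here-pair with toℕ i ℕ.<ᵇ toℕ j | ℕ.<⇒<ᵇ i<j
  ... | true | _ = here refl
  columns : ∀ js → j ∈ js → Any (λ j′ → (i , j) ∈ pairsFrom i j′) js
  columns (_ ∷ js) (here refl) = here here-pair
  columns (_ ∷ js) (there j∈) = there (columns js j∈)
  rows : ∀ is → i ∈ is → Any (λ i′ → (i , j) ∈ concatMap (pairsFrom i′) (allFin m)) is
  rows (_ ∷ is) (here refl) = here (∈-concatMap⁺ _ (columns (allFin m) (∈-allFin j)))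
  rows (_ ∷ is) (there i∈) = there (rows is i∈)

pairs-< : ∀ {m} (i j : Fin m) → (i , j) ∈ pairs m → toℕ i ℕ.< toℕ j
pairs-< {m} i j p = rows (allFin m) (∈-concatMap⁻ _ {xs = allFin m} p)
  where
  columns : ∀ {i′} js → Any (λ j′ → (i , j) ∈ pairsFrom i′ j′) js → toℕ i ℕ.< toℕ j
  columns {i′} (j′ ∷ js) (here q) with toℕ i′ ℕ.<ᵇ toℕ j′ in lt
  columns (j′ ∷ js) (here (here refl)) | true = ℕ.<ᵇ⇒< _ _ (Equivalence.from T-≡ lt)
  columns (_ ∷ js) (there q) = columns js q
  rows : ∀ is → Any (λ i′ → (i , j) ∈ concatMap (pairsFrom i′) (allFin m)) is → toℕ i ℕ.< toℕ j
  rows (_ ∷ is) (here q) = columns (allFin m) (∈-concatMap⁻ _ {xs = allFin m} q)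
  rows (_ ∷ is) (there q) = rows is q

module Semantics {U : Set} (S : Str U) where

  V : Set
  V = Fin (N S)

  ∈-verts : ∀ {v} → dom S v ≡ true → v ∈ verts S
  ∈-verts dv = ∈-filterᵇ⁺ (dom S) (allFin (N S)) (∈-allFin _) dv

  verts-dom : ∀ {v} → v ∈ verts S → dom S v ≡ true
  verts-dom v∈ = proj₂ (∈-filterᵇ⁻ (dom S) (allFin (N S)) v∈)

  sat-cong : ∀ {n} (φ : Fm U n) {ρ ρ′ : Fin n → V} → (∀ i → ρ i ≡ ρ′ i) → sat S ρ φ ≡ sat S ρ′ φ
  sat-cong tt h = refl
  sat-cong ff h = refl
  sat-cong (x ≐ y) h rewrite h x | h y = refl
  sat-cong (e x y) h rewrite h x | h y = refl
  sat-cong (P u x) h rewrite h x = refl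
  sat-cong (¬′ φ) h = cong not (sat-cong φ h)
  sat-cong (φ ∧′ ψ) h = cong₂ _∧_ (sat-cong φ h) (sat-cong ψ h)
  sat-cong (φ ∨′ ψ) h = cong₂ _∨_ (sat-cong φ h) (sat-cong ψ h)
  sat-cong (φ ⇒′ ψ) h = cong₂ _∨_ (cong not (sat-cong φ h)) (sat-cong ψ h)
  sat-cong (∃′ φ) h = any-cong _ _ (λ v → sat-cong φ λ { zero → refl ; (suc i) → h i }) (verts S)
  sat-cong (∀′ φ) h = all-cong _ _ (λ v → sat-cong φ λ { zero → refl ; (suc i) → h i }) (verts S)

  sat-∃ : ∀ {n} (φ : Fm U (suc n)) (ρ : Fin n → V) →
    sat S ρ (∃′ φ) ≡ any (λ v → sat S (v ∷ᵥ ρ) φ) (verts S)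
  sat-∃ φ ρ = any-cong _ _ (λ v → sat-cong φ λ { zero → refl ; (suc i) → refl }) (verts S)

  sat-∀ : ∀ {n} (φ : Fm U (suc n)) (ρ : Fin n → V) →
    sat S ρ (∀′ φ) ≡ all (λ v → sat S (v ∷ᵥ ρ) φ) (verts S)
  sat-∀ φ ρ = all-cong _ _ (λ v → sat-cong φ λ { zero → refl ; (suc i) → refl }) (verts S)

  sat-ren : ∀ {a b} (φ : Fm U a) (σ : Fin a → Fin b) (ρ : Fin b → V) →
    sat S ρ (ren σ φ) ≡ sat S (λ i → ρ (σ i)) φ
  sat-ren tt σ ρ = refl
  sat-ren ff σ ρ = refl
  sat-ren (x ≐ y) σ ρ = refl
  sat-ren (e x y) σ ρ = refl
  sat-ren (P u x) σ ρ = refl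
  sat-ren (¬′ φ) σ ρ = cong not (sat-ren φ σ ρ)
  sat-ren (φ ∧′ ψ) σ ρ = cong₂ _∧_ (sat-ren φ σ ρ) (sat-ren ψ σ ρ)
  sat-ren (φ ∨′ ψ) σ ρ = cong₂ _∨_ (sat-ren φ σ ρ) (sat-ren ψ σ ρ)
  sat-ren (φ ⇒′ ψ) σ ρ = cong₂ _∨_ (cong not (sat-ren φ σ ρ)) (sat-ren ψ σ ρ)
  sat-ren (∃′ φ) σ ρ = any-cong _ _ (λ v → trans (sat-ren φ (ext σ) _)
                          (sat-cong φ λ { zero → refl ; (suc i) → refl })) (verts S)
  sat-ren (∀′ φ) σ ρ = all-cong _ _ (λ v → trans (sat-ren φ (ext σ) _)
                          (sat-cong φ λ { zero → refl ; (suc i) → refl })) (verts S)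

  sat-coreAt : ∀ {k} r (ψ : LFm U 0) (i : Fin k) (ρ : Fin (k ℕ.+ 0) → V) →
    sat S ρ (coreAt r ψ i) ≡ sat S (λ _ → ρ (xv i)) (loc r ψ)
  sat-coreAt r ψ i ρ = sat-ren (loc r ψ) (λ _ → xv i) ρ

  AllDom : ∀ {k} → (Fin k → V) → Set
  AllDom σ = ∀ i → dom S (σ i) ≡ true

  sat-exN⁻ : ∀ {n} k (φ : Fm U (k ℕ.+ n)) (ρ : Fin n → V) → sat S ρ (exN k φ) ≡ true →
    Σ (Fin k → V) λ σ → AllDom σ × sat S (σ ++ᵉ ρ) φ ≡ true
  sat-exN⁻ zero φ ρ p = []ᵥ , (λ ()) , p
  sat-exN⁻ (suc k) φ ρ p with sat-exN⁻ k (∃′ φ) ρ p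
  ... | σ , dσ , q with any-true⁻ _ (verts S) (trans (sym (sat-∃ φ (σ ++ᵉ ρ))) q)
  ... | v , v∈ , r = v ∷ᵥ σ , (λ { zero → verts-dom v∈ ; (suc i) → dσ i }) ,
                     trans (sat-cong φ λ { zero → refl ; (suc i) → refl }) r

  sat-exN⁺ : ∀ {n} k (φ : Fm U (k ℕ.+ n)) (ρ : Fin n → V) (σ : Fin k → V) → AllDom σ →
    sat S (σ ++ᵉ ρ) φ ≡ true → sat S ρ (exN k φ) ≡ true
  sat-exN⁺ zero φ ρ σ dσ p = p
  sat-exN⁺ (suc k) φ ρ σ dσ p = sat-exN⁺ k (∃′ φ) ρ (λ j → σ (suc j)) (λ j → dσ (suc j))
    (trans (sat-∃ φ _) (any-true⁺ _ (verts S) (∈-verts (dσ zero))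
      (trans (sat-cong φ λ { zero → refl ; (suc i) → refl }) p)))

  sat-allN⁻ : ∀ {n} k (φ : Fm U (k ℕ.+ n)) (ρ : Fin n → V) → sat S ρ (allN k φ) ≡ true →
    (σ : Fin k → V) → AllDom σ → sat S (σ ++ᵉ ρ) φ ≡ true
  sat-allN⁻ zero φ ρ p σ dσ = p
  sat-allN⁻ (suc k) φ ρ p σ dσ =
    trans (sat-cong φ λ { zero → refl ; (suc i) → refl })
      (all-true⁻ _ (verts S)
        (trans (sym (sat-∀ φ _)) (sat-allN⁻ k (∀′ φ) ρ p (λ j → σ (suc j)) (λ j → dσ (suc j))))
        (∈-verts (dσ zero)))

  sat-allN⁺ : ∀ {n} k (φ : Fm U (k ℕ.+ n)) (ρ : Fin n → V) →
    ((σ : Fin k → V) → AllDom σ → sat S (σ ++ᵉ ρ) φ ≡ true) → sat S ρ (allN k φ) ≡ true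
  sat-allN⁺ zero φ ρ h = h []ᵥ (λ ())
  sat-allN⁺ (suc k) φ ρ h = sat-allN⁺ k (∀′ φ) ρ λ σ dσ →
    trans (sat-∀ φ _) (all-true⁺ _ (verts S) λ v v∈ →
      trans (sat-cong φ λ { zero → refl ; (suc i) → refl })
        (h (v ∷ᵥ σ) λ { zero → verts-dom v∈ ; (suc i) → dσ i }))

  sat-⋀⁻ : ∀ {n} {A : Set} (f : A → Fm U n) xs ρ → sat S ρ (⋀ (map f xs)) ≡ true →
    ∀ {x} → x ∈ xs → sat S ρ (f x) ≡ true
  sat-⋀⁻ f (y ∷ xs) ρ p (here refl) = ∧-true⁻ˡ p
  sat-⋀⁻ f (y ∷ xs) ρ p (there x∈) = sat-⋀⁻ f xs ρ (∧-true⁻ʳ {sat S ρ (f y)} p) x∈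

  sat-⋀⁺ : ∀ {n} {A : Set} (f : A → Fm U n) xs ρ → (∀ x → x ∈ xs → sat S ρ (f x) ≡ true) →
    sat S ρ (⋀ (map f xs)) ≡ true
  sat-⋀⁺ f [] ρ h = refl
  sat-⋀⁺ f (x ∷ xs) ρ h = ∧-true⁺ (h x (here refl)) (sat-⋀⁺ f xs ρ λ y y∈ → h y (there y∈))

  sat-⋁⁻ : ∀ {n} {A : Set} (f : A → Fm U n) xs ρ → sat S ρ (⋁ (map f xs)) ≡ true →
    Σ A λ x → x ∈ xs × sat S ρ (f x) ≡ true
  sat-⋁⁻ f (x ∷ xs) ρ p with ∨-true⁻ {sat S ρ (f x)} p
  ... | inj₁ q = x , here refl , q
  ... | inj₂ q with sat-⋁⁻ f xs ρ q
  ... | y , y∈ , r = y , there y∈ , r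

  sat-⋁-false⁻ : ∀ {n} {A : Set} (f : A → Fm U n) xs ρ → sat S ρ (⋁ (map f xs)) ≡ false →
    ∀ {x} → x ∈ xs → sat S ρ (f x) ≡ false
  sat-⋁-false⁻ f (y ∷ xs) ρ p (here refl) with sat S ρ (f y)
  ... | false = refl
  sat-⋁-false⁻ f (y ∷ xs) ρ p (there x∈) with sat S ρ (f y)
  ... | false = sat-⋁-false⁻ f xs ρ p x∈

  sat-farApart⁻ : ∀ {K r} (ρ : Fin (K ℕ.+ 0) → V) → sat S ρ (farApart K r) ≡ true →
    ∀ i j → toℕ i ℕ.< toℕ j → sat S ρ (dle (2 ℕ.* r) (xv i) (xv j)) ≡ false
  sat-farApart⁻ {K} ρ far i j i<j = not-true⁻ (sat-⋀⁻ _ (pairs K) ρ far (∈-pairs i j i<j))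

  sat-farApart⁺ : ∀ {K r} (ρ : Fin (K ℕ.+ 0) → V) →
    (∀ i j → toℕ i ℕ.< toℕ j → sat S ρ (dle (2 ℕ.* r) (xv i) (xv j)) ≡ false) → sat S ρ (farApart K r) ≡ true
  sat-farApart⁺ {K} ρ apart = sat-⋀⁺ _ (pairs K) ρ λ { (i , j) ij∈ → not-true⁺ (apart i j (pairs-< i j ij∈)) }

module Walks {U : Set} (S : Str U) where
  open Semantics S

  Step : V → V → Set
  Step a b = a ≡ b ⊎ adj S a b ≡ true

  -- The walks witnessing d(x,y) ≤ k: exactly k (possibly stationary) steps inside the domain.
  data Walk : ℕ → V → V → Set where
    done : ∀ {a} → Walk 0 a a
    step : ∀ {k a b c} → Step a b → dom S b ≡ true → Walk k b c → Walk (suc k) a c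

  IsWalkFn : ∀ k → (Fin (suc k) → V) → Set
  IsWalkFn k f = AllDom f × (∀ (j : Fin k) → Step (f (inject₁ j)) (f (suc j)))

  walkFn⇒Walk : ∀ k (f : Fin (suc k) → V) → IsWalkFn k f → Walk k (f zero) (f (fromℕ k))
  walkFn⇒Walk zero f _ = done
  walkFn⇒Walk (suc k) f (df , sf) =
    step (sf zero) (df (suc zero)) (walkFn⇒Walk k (λ i → f (suc i)) ((λ i → df (suc i)) , λ j → sf (suc j)))

  Walk⇒walkFn : ∀ {k a b} → dom S a ≡ true → Walk k a b →
    Σ (Fin (suc k) → V) λ f → IsWalkFn k f × f zero ≡ a × f (fromℕ k) ≡ b
  Walk⇒walkFn {a = a} da done = (λ _ → a) , ((λ _ → da) , (λ ())) , refl , refl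
  Walk⇒walkFn {a = a} da (step s db w) with Walk⇒walkFn db w
  ... | f , (df , sf) , refl , fk = a ∷ᵥ f , ((λ { zero → da ; (suc i) → df i }) ,
          (λ { zero → s ; (suc j) → sf j })) , refl , fk

  sat-dle⁻ : ∀ {n} r (x y : Fin n) (ρ : Fin n → V) → sat S ρ (dle r x y) ≡ true → Walk r (ρ x) (ρ y)
  sat-dle⁻ {n} r x y ρ p with sat-exN⁻ (suc r) _ ρ p
  ... | σ , dσ , q = subst₂ (Walk r) f₀ f₁ (walkFn⇒Walk r f ((λ i → df i) , steps))
    where
    env = σ ++ᵉ ρ
    f : Fin (suc r) → V
    f i = env (opposite i ↑ˡ n)
    df : AllDom f
    df i = subst (λ v → dom S v ≡ true) (sym (++ᵉ-↑ˡ σ ρ (opposite i))) (dσ (opposite i))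
    endpoints = ⌊ env (opposite zero ↑ˡ n) Fin.≟ env (suc r ↑ʳ x) ⌋
    f₀ : f zero ≡ ρ x
    f₀ = trans (⌊≟⌋-true⁻ (∧-true⁻ˡ q)) (++ᵉ-↑ʳ σ ρ x)
    f₁ : f (fromℕ r) ≡ ρ y
    f₁ = trans (⌊≟⌋-true⁻ (∧-true⁻ˡ (∧-true⁻ʳ {endpoints} q))) (++ᵉ-↑ʳ σ ρ y)
    steps : ∀ (j : Fin r) → Step (f (inject₁ j)) (f (suc j))
    steps j with ∨-true⁻ (sat-⋀⁻ _ (allFin r) env (∧-true⁻ʳ (∧-true⁻ʳ {endpoints} q)) (∈-allFin j))
    ... | inj₁ s = inj₁ (⌊≟⌋-true⁻ s)
    ... | inj₂ s = inj₂ s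

  sat-dle⁺ : ∀ {n} r (x y : Fin n) (ρ : Fin n → V) → dom S (ρ x) ≡ true → Walk r (ρ x) (ρ y) →
    sat S ρ (dle r x y) ≡ true
  sat-dle⁺ {n} r x y ρ dx w with Walk⇒walkFn dx w
  ... | f , (df , sf) , f₀ , f₁ = sat-exN⁺ (suc r) _ ρ σ (λ i → df (opposite i))
        (∧-true⁺ (endpoint zero x f₀) (∧-true⁺ (endpoint (fromℕ r) y f₁)
          (sat-⋀⁺ _ (allFin r) _ λ j _ → step-ok j)))
    where
    σ : Fin (suc r) → V
    σ i = f (opposite i)
    z≡ : ∀ i → (σ ++ᵉ ρ) (opposite i ↑ˡ n) ≡ f i
    z≡ i = trans (++ᵉ-↑ˡ σ ρ (opposite i)) (cong f (opposite-involutive i))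
    endpoint : ∀ i z → f i ≡ ρ z → ⌊ (σ ++ᵉ ρ) (opposite i ↑ˡ n) Fin.≟ (σ ++ᵉ ρ) (suc r ↑ʳ z) ⌋ ≡ true
    endpoint i z fi = subst₂ (λ a b → ⌊ a Fin.≟ b ⌋ ≡ true) (sym (z≡ i))
                        (trans fi (sym (++ᵉ-↑ʳ σ ρ z))) (⌊≟⌋-refl _)
    step-ok : ∀ (j : Fin r) →
      (⌊ (σ ++ᵉ ρ) (opposite (inject₁ j) ↑ˡ n) Fin.≟ (σ ++ᵉ ρ) (opposite (suc j) ↑ˡ n) ⌋ ∨
       adj S ((σ ++ᵉ ρ) (opposite (inject₁ j) ↑ˡ n)) ((σ ++ᵉ ρ) (opposite (suc j) ↑ˡ n))) ≡ true
    step-ok j rewrite z≡ (inject₁ j) | z≡ (suc j) with sf j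
    ... | inj₁ s rewrite s = ∨-true⁺ˡ (⌊≟⌋-refl (f (suc j)))
    ... | inj₂ s = ∨-true⁺ʳ s

  _++ʷ_ : ∀ {j k a b c} → Walk j a b → Walk k b c → Walk (j ℕ.+ k) a c
  done ++ʷ w′ = w′
  step s d w ++ʷ w′ = step s d (w ++ʷ w′)

  splitWalk : ∀ j {k a c} → Walk (j ℕ.+ k) a c → Σ V λ b → Walk j a b × Walk k b c
  splitWalk zero w = _ , done , w
  splitWalk (suc j) (step s d w) with splitWalk j w
  ... | b , w₁ , w₂ = b , step s d w₁ , w₂

  module _ (adj-symmetric : ∀ u v → adj S u v ≡ adj S v u) where

    snocWalk : ∀ {k a b c} → Walk k a b → Step b c → dom S c ≡ true → Walk (suc k) a c
    snocWalk done s d = step s d done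
    snocWalk (step s′ d′ w) s d = step s′ d′ (snocWalk w s d)

    reverseWalk : ∀ {k a b} → dom S a ≡ true → Walk k a b → Walk k b a
    reverseWalk da done = done
    reverseWalk da (step (inj₁ refl) d w) = snocWalk (reverseWalk d w) (inj₁ refl) da
    reverseWalk {a = a} da (step {b = b} (inj₂ ab) d w) =
      snocWalk (reverseWalk d w) (inj₂ (trans (adj-symmetric b a) ab)) da

module IntegerFacts where
  open import Data.Integer hiding (suc; _≟_)
  open import Data.Integer.Properties hiding (_≟_)
  open import Data.Integer.Tactic.RingSolver using (solve-∀)

  ≤-by-diff : ∀ {a b} d → 0ℤ ≤ d → b - a ≡ d → a ≤ b
  ≤-by-diff d 0≤d eq = 0≤i-j⇒j≤i (subst (0ℤ ≤_) (sym eq) 0≤d)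

  0≤+ : ∀ n → 0ℤ ≤ + n
  0≤+ n = +≤+ z≤n

  ℕ≤⇒0≤- : ∀ {m n} → m ℕ.≤ n → 0ℤ ≤ + n - + m
  ℕ≤⇒0≤- m≤n = i≤j⇒0≤j-i (+≤+ m≤n)

  ≤⇒∃+ : ∀ {a b} → a ≤ b → Σ ℕ λ k → b ≡ a + + k
  ≤⇒∃+ {a} {b} a≤b with b - a in eq | i≤j⇒0≤j-i a≤b
  ... | + k | _ = k , trans (b≡a+[b-a] a b) (cong (λ z → a + z) eq)
    where
    b≡a+[b-a] : ∀ a b → b ≡ a + (b - a)
    b≡a+[b-a] = solve-∀

  +1≤-contra : ∀ {a b} → a ≤ b → b + 1ℤ ≤ a → ⊥
  +1≤-contra {a} {b} a≤b b+1≤a = 0≰-1 (subst (0ℤ ≤_) (b-[b+1] b) (i≤j⇒0≤j-i (≤-trans b+1≤a a≤b)))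
    where
    b-[b+1] : ∀ b → b - (b + 1ℤ) ≡ -1ℤ
    b-[b+1] = solve-∀
    0≰-1 : 0ℤ ≤ -1ℤ → ⊥
    0≰-1 ()

  ∣∣≤⇒bounds : ∀ d k → ∣ d ∣ ℕ.≤ k → d ≤ + k × - + k ≤ d
  ∣∣≤⇒bounds (+ n) k n≤k = +≤+ n≤k , neg-≤-pos
  ∣∣≤⇒bounds -[1+ n ] (suc k) (s≤s n≤k) = -≤+ , -≤- n≤k

  ∣-∣-self : ∀ x → ∣ x - x ∣ ≡ 0
  ∣-∣-self x = cong ∣_∣ (+-inverseʳ x)

  ∣-∣-triangle : ∀ x y z → ∣ x - z ∣ ℕ.≤ ∣ x - y ∣ ℕ.+ ∣ y - z ∣
  ∣-∣-triangle x y z =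
    subst (λ d → ∣ d ∣ ℕ.≤ ∣ x - y ∣ ℕ.+ ∣ y - z ∣) (sym (split x y z)) (∣i+j∣≤∣i∣+∣j∣ (x - y) (y - z))
    where
    split : ∀ x y z → x - z ≡ (x - y) + (y - z)
    split = solve-∀

  inRange-true⁺ : ∀ {lo hi x} → lo ≤ x → x ≤ hi → inRange lo hi x ≡ true
  inRange-true⁺ lo≤x x≤hi
    rewrite Equivalence.to T-≡ (≤⇒≤ᵇ lo≤x) | Equivalence.to T-≡ (≤⇒≤ᵇ x≤hi) = refl

  inRange-true⁻ : ∀ {lo hi x} → inRange lo hi x ≡ true → lo ≤ x × x ≤ hi
  inRange-true⁻ {lo} {hi} {x} p with lo ≤ᵇ x in eq₁ | x ≤ᵇ hi in eq₂
  inRange-true⁻ refl | true | true = ≤ᵇ⇒≤ (Equivalence.from T-≡ eq₁) , ≤ᵇ⇒≤ (Equivalence.from T-≡ eq₂)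

  quotient-unique : ∀ s t₁ t₂ q₁ q₂ → t₁ * + s + q₁ ≡ t₂ * + s + q₂ →
    q₁ - q₂ + 1ℤ ≤ + s → q₂ - q₁ + 1ℤ ≤ + s → t₁ ≡ t₂
  quotient-unique s t₁ t₂ q₁ q₂ eq b₁ b₂ with t₁ - t₂ in diff
  ... | + zero = trans (t≡[t-u]+u t₁ t₂) (trans (cong (_+ t₂) diff) (+-identityˡ t₂))
    where
    t≡[t-u]+u : ∀ t u → t ≡ (t - u) + u
    t≡[t-u]+u = solve-∀
  ... | +[1+ j ] = ⊥-elim (+1≤-contra s≤q₂-q₁ b₂)
    where
    multiple : + suc j * + s ≡ q₂ - q₁
    multiple = trans (cong (_* + s) (sym diff)) (rearrange t₁ t₂ q₁ q₂ (+ s) eq)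
      where
      rearrange : ∀ t₁ t₂ q₁ q₂ s → t₁ * s + q₁ ≡ t₂ * s + q₂ → (t₁ - t₂) * s ≡ q₂ - q₁
      rearrange t₁ t₂ q₁ q₂ s eq = trans (lhs t₁ t₂ q₁ s) (trans (cong (λ z → z - t₂ * s - q₁) eq) (rhs t₂ q₁ q₂ s))
        where
        lhs : ∀ t₁ t₂ q₁ s → (t₁ - t₂) * s ≡ (t₁ * s + q₁) - t₂ * s - q₁
        lhs = solve-∀
        rhs : ∀ t₂ q₁ q₂ s → (t₂ * s + q₂) - t₂ * s - q₁ ≡ q₂ - q₁
        rhs = solve-∀
    s≤q₂-q₁ : + s ≤ q₂ - q₁
    s≤q₂-q₁ = subst (+ s ≤_) (trans (pos-* (suc j) s) multiple) (+≤+ (ℕ.m≤m+n s (j ℕ.* s)))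
  ... | -[1+ j ] = ⊥-elim (+1≤-contra s≤q₁-q₂ b₁)
    where
    multiple : + suc j * + s ≡ q₁ - q₂
    multiple = trans (cong (_* + s) (sym (cong -_ diff))) (rearrange t₁ t₂ q₁ q₂ (+ s) eq)
      where
      rearrange : ∀ t₁ t₂ q₁ q₂ s → t₁ * s + q₁ ≡ t₂ * s + q₂ → (- (t₁ - t₂)) * s ≡ q₁ - q₂
      rearrange t₁ t₂ q₁ q₂ s eq = trans (lhs t₁ t₂ q₁ q₂ s) (trans (cong (λ z → (t₂ * s + q₂) - z + q₁ - q₂) eq) (rhs t₂ q₁ q₂ s))
        where
        lhs : ∀ t₁ t₂ q₁ q₂ s → (- (t₁ - t₂)) * s ≡ (t₂ * s + q₂) - (t₁ * s + q₁) + q₁ - q₂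
        lhs = solve-∀
        rhs : ∀ t₂ q₁ q₂ s → (t₂ * s + q₂) - (t₂ * s + q₂) + q₁ - q₂ ≡ q₁ - q₂
        rhs = solve-∀
    s≤q₁-q₂ : + s ≤ q₁ - q₂
    s≤q₁-q₂ = subst (+ s ≤_) (trans (pos-* (suc j) s) multiple) (+≤+ (ℕ.m≤m+n s (j ℕ.* s)))

module Covers (r ℓ : ℕ) (2r<ℓ : 2 ℕ.* r ℕ.< ℓ) where
  open import Data.Integer hiding (suc; _≟_)
  open import Data.Integer.Properties hiding (_≟_)
  open import Data.Integer.DivMod using (_/ℕ_; _%ℕ_; a≡a%ℕn+[a/ℕn]*n; n%ℕd<d)
  open import Data.Integer.Tactic.RingSolver using (solve-∀)
  open IntegerFacts

  s : ℕ
  s = ℓ ℕ.∸ 2 ℕ.* r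

  instance
    s-nonZero : ℕ.NonZero s
    s-nonZero = ℕ.>-nonZero (ℕ.m<n⇒0<n∸m 2r<ℓ)

  ℓ≡s+2r : + ℓ ≡ + s + + (2 ℕ.* r)
  ℓ≡s+2r = trans (cong +_ (sym (ℕ.m∸n+n≡m (ℕ.<⇒≤ 2r<ℓ)))) (pos-+ s (2 ℕ.* r))

  %ℕ-unique : ∀ a q D → q ℕ.< s → a ≡ + q + D * + s → a %ℕ s ≡ q
  %ℕ-unique a q D q<s a≡ = +-injective (trans (isolate (+ (a %ℕ s)) (a /ℕ s) (+ s) a (a≡a%ℕn+[a/ℕn]*n a s))
      (trans (cong (λ z → a - z * + s) same-quotient) (trans (cong (λ z → z - D * + s) a≡) (cancel (+ q) D (+ s)))))
    where
    isolate : ∀ m d s a → a ≡ m + d * s → m ≡ a - d * s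
    isolate m d s .(m + d * s) refl = m≡[m+ds]-ds m d s
      where
      m≡[m+ds]-ds : ∀ m d s → m ≡ (m + d * s) - d * s
      m≡[m+ds]-ds = solve-∀
    cancel : ∀ q d s → q + d * s - d * s ≡ q
    cancel = solve-∀
    swap : ∀ m d s → m + d * s ≡ d * s + m
    swap = solve-∀
    small : ∀ {m n} → m ℕ.< s → + m - + n + 1ℤ ≤ + s
    small {m} {n} m<s = ≤-by-diff ((+ s - (1ℤ + + m)) + + n) (+-mono-≤ (ℕ≤⇒0≤- m<s) (0≤+ n)) (rearrange (+ s) (+ m) (+ n))
      where
      rearrange : ∀ s m n → s - (m - n + 1ℤ) ≡ (s - (1ℤ + m)) + n
      rearrange = solve-∀
    same-quotient : a /ℕ s ≡ D
    same-quotient = quotient-unique s (a /ℕ s) D (+ (a %ℕ s)) (+ q)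
      (trans (sym (swap (+ (a %ℕ s)) (a /ℕ s) (+ s))) (trans (sym (a≡a%ℕn+[a/ℕn]*n a s)) (trans a≡ (swap (+ q) D (+ s)))))
      (small {n = q} (n%ℕd<d a s)) (small {n = a %ℕ s} q<s)

  forbiddenCovers : ℤ → ℕ → List ℕ
  forbiddenCovers a w = map (λ d → (a - + d) %ℕ s) (downFrom w)

  length-forbiddenCovers : ∀ a w → length (forbiddenCovers a w) ≡ w
  length-forbiddenCovers a w = trans (length-map _ (downFrom w)) (length-downFrom w)

  module Cover (c : ℕ) where

    block : ℤ → ℤ
    block x = (x - + c) /ℕ s

    offset : ℤ → ℕ
    offset x = (x - + c) %ℕ s

    offset<s : ∀ x → offset x ℕ.< s
    offset<s x = n%ℕd<d (x - + c) s

    block-offset : ∀ x → x ≡ start ℓ r c (block x) + + offset x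
    block-offset x = trans (x≡c+[x-c] x (+ c)) (trans (cong (λ z → + c + z) (a≡a%ℕn+[a/ℕn]*n (x - + c) s))
      (regroup (+ c) (+ offset x) (block x) (+ s)))
      where
      x≡c+[x-c] : ∀ x c → x ≡ c + (x - c)
      x≡c+[x-c] = solve-∀
      regroup : ∀ c o b s → c + (o + b * s) ≡ c + b * s + o
      regroup = solve-∀

    -- Consecutive intervals I_t = [first t , last t] overlap in 2r layers; block x is the t with
    -- first t ≤ x < first t + s, and Interior x says that x ∈ M_{2r}(I_{block x}).
    Interior : ℤ → Set
    Interior x = 2 ℕ.* r ℕ.≤ offset x

    first last : ℤ → ℤ
    first t = start ℓ r c t
    last t = first t + + ℓ - 1ℤ

    record Inside (d : ℕ) (t x : ℤ) : Set where
      constructor inside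
      field
        lower : first t + + d ≤ x
        upper : x + + d ≤ last t

    Inside-Md⁺ : ∀ {d t x} → Inside d t x → pre id (Md ℓ d (ivl ℓ r c t)) x ≡ true
    Inside-Md⁺ {d} {t} {x} (inside lo hi) = inRange-true⁺ lo
      (≤-by-diff (last t - (x + + d)) (i≤j⇒0≤j-i hi) (rearrange (first t) (+ ℓ) (+ d) x))
      where
      rearrange : ∀ i l d x → (i + l - d - 1ℤ) - x ≡ (i + l - 1ℤ) - (x + d)
      rearrange = solve-∀

    Inside-Md⁻ : ∀ {d t x} → pre id (Md ℓ d (ivl ℓ r c t)) x ≡ true → Inside d t x
    Inside-Md⁻ {d} {t} {x} p with inRange-true⁻ {first t + + d} {first t + + ℓ - + d - 1ℤ} {x} p
    ... | lo , hi = inside lo (≤-by-diff ((first t + + ℓ - + d - 1ℤ) - x) (i≤j⇒0≤j-i hi) (rearrange (first t) (+ ℓ) (+ d) x))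
      where
      rearrange : ∀ i l d x → (i + l - 1ℤ) - (x + d) ≡ (i + l - d - 1ℤ) - x
      rearrange = solve-∀

    Inside-ivl : ∀ {t x} → Inside 0 t x → pre id (ivl ℓ r c t) x ≡ true
    Inside-ivl {t} {x} (inside lo hi) =
      inRange-true⁺ (subst (_≤ x) (+-identityʳ (first t)) lo) (subst (_≤ last t) (+-identityʳ x) hi)

    Inside-ball : ∀ {d k t x} w → Inside d t x → ∣ x - w ∣ ℕ.≤ k → k ℕ.≤ d → Inside 0 t w
    Inside-ball {d} {k} {t} {x} w (inside lo hi) ∣x-w∣≤k k≤d with ∣∣≤⇒bounds (x - w) k ∣x-w∣≤k
    ... | x-w≤k , -k≤x-w = inside
      (≤-by-diff ((x - (first t + + d)) + (+ d - + k) + (+ k - (x - w)))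
        (+-mono-≤ (+-mono-≤ (i≤j⇒0≤j-i lo) (ℕ≤⇒0≤- k≤d)) (i≤j⇒0≤j-i x-w≤k)) (lower (first t) x w (+ d) (+ k)))
      (≤-by-diff ((last t - (x + + d)) + (+ d - + k) + ((x - w) - - + k))
        (+-mono-≤ (+-mono-≤ (i≤j⇒0≤j-i hi) (ℕ≤⇒0≤- k≤d)) (i≤j⇒0≤j-i -k≤x-w)) (upper (last t) x w (+ d) (+ k)))
      where
      lower : ∀ i x w d k → w - (i + 0ℤ) ≡ (x - (i + d)) + (d - k) + (k - (x - w))
      lower = solve-∀
      upper : ∀ l x w d k → l - (w + 0ℤ) ≡ (l - (x + d)) + (d - k) + ((x - w) - - k)
      upper = solve-∀

    Inside-self : ∀ {d t x} → Inside d t x → Inside 0 t x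
    Inside-self {x = x} ins = Inside-ball x ins (ℕ.≤-reflexive (∣-∣-self x)) z≤n

    interior-Inside : ∀ {x} → Interior x → Inside (2 ℕ.* r) (block x) x
    interior-Inside {x} 2r≤q = inside
      (≤-by-diff (+ q - + (2 ℕ.* r)) (ℕ≤⇒0≤- 2r≤q) (trans (cong (_- (i + + (2 ℕ.* r))) (block-offset x)) (lower i (+ q) (+ (2 ℕ.* r)))))
      (≤-by-diff (+ s - (1ℤ + + q)) (ℕ≤⇒0≤- (offset<s x))
        (trans (cong₂ (λ l y → i + l - 1ℤ - (y + + (2 ℕ.* r))) ℓ≡s+2r (block-offset x)) (upper i (+ q) (+ s) (+ (2 ℕ.* r)))))
      where
      q = offset x
      i = first (block x)
      lower : ∀ i q d → (i + q) - (i + d) ≡ q - d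
      lower = solve-∀
      upper : ∀ i q s d → (i + (s + d) - 1ℤ) - ((i + q) + d) ≡ s - (1ℤ + q)
      upper = solve-∀

    interior-block : ∀ {x t} → Interior x → Inside 0 t x → block x ≡ t
    interior-block {x} {t} 2r≤q (inside lo hi) = quotient-unique s (block x) t (+ q) q′ same-point b₁ b₂
      where
      q = offset x
      q′ = x - first t
      same-point : block x * + s + + q ≡ t * + s + q′
      same-point = trans (drop-c (block x) (+ s) (+ q) (+ c)) (trans (cong (_- + c) (sym (block-offset x))) (shift x (+ c) t (+ s)))
        where
        drop-c : ∀ b s q c → b * s + q ≡ (c + b * s + q) - c
        drop-c = solve-∀
        shift : ∀ x c t s → x - c ≡ t * s + (x - (c + t * s))
        shift = solve-∀
      b₁ : + q - q′ + 1ℤ ≤ + s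
      b₁ = ≤-by-diff ((+ s - (1ℤ + + q)) + (x - (first t + 0ℤ))) (+-mono-≤ (ℕ≤⇒0≤- (offset<s x)) (i≤j⇒0≤j-i lo))
             (rearrange (+ s) (+ q) x (first t))
        where
        rearrange : ∀ s q x i → s - (q - (x - i) + 1ℤ) ≡ (s - (1ℤ + q)) + (x - (i + 0ℤ))
        rearrange = solve-∀
      b₂ : q′ - + q + 1ℤ ≤ + s
      b₂ = ≤-by-diff ((last t - (x + 0ℤ)) + (+ q - + (2 ℕ.* r))) (+-mono-≤ (i≤j⇒0≤j-i hi) (ℕ≤⇒0≤- 2r≤q))
             (rearrange (+ s) (+ q) x (first t) (+ ℓ) (+ (2 ℕ.* r)) ℓ≡s+2r)
        where
        rearrange : ∀ s q x i l d → l ≡ s + d → s - ((x - i) - q + 1ℤ) ≡ ((i + l - 1ℤ) - (x + 0ℤ)) + (q - d)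
        rearrange s q x i .(s + d) d refl = go s q x i d
          where
          go : ∀ s q x i d → s - ((x - i) - q + 1ℤ) ≡ ((i + (s + d) - 1ℤ) - (x + 0ℤ)) + (q - d)
          go = solve-∀

    interior-close-block : ∀ {x y} → Interior x → Interior y → ∣ x - y ∣ ℕ.≤ 2 ℕ.* r → block y ≡ block x
    interior-close-block {x} {y} int-x int-y ∣x-y∣≤2r =
      interior-block int-y (Inside-ball y (interior-Inside {x} int-x) ∣x-y∣≤2r ℕ.≤-refl)

    allowed-offset : ∀ a w → c ℕ.< s → c ∉ forbiddenCovers a w → w ℕ.≤ (a - + c) %ℕ s
    allowed-offset a w c<s c∉ with w ℕ.≤? (a - + c) %ℕ s
    ... | yes w≤q = w≤q
    ... | no w≰q = ⊥-elim (c∉ (subst (_∈ forbiddenCovers a w) hits (∈-map⁺ (λ d → (a - + d) %ℕ s) (∈-downFrom⁺ (ℕ.≰⇒> w≰q)))))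
      where
      q = (a - + c) %ℕ s
      ∈-downFrom⁺ : ∀ {i n} → i ℕ.< n → i ∈ downFrom n
      ∈-downFrom⁺ {i} {suc n} (s≤s i≤n) with ℕ.m≤n⇒m<n∨m≡n i≤n
      ... | inj₁ i<n = there (∈-downFrom⁺ i<n)
      ... | inj₂ refl = here refl
      shift : ∀ a c q d s → a - c ≡ q + d * s → a - q ≡ c + d * s
      shift a c q d s eq = trans (regroup a c q) (trans (cong (λ z → c + (z - q)) eq) (cancel c q d s))
        where
        regroup : ∀ a c q → a - q ≡ c + ((a - c) - q)
        regroup = solve-∀
        cancel : ∀ c q d s → c + ((q + d * s) - q) ≡ c + d * s
        cancel = solve-∀
      hits : (a - + q) %ℕ s ≡ c
      hits = %ℕ-unique (a - + q) c ((a - + c) /ℕ s) c<s (shift a (+ c) (+ q) ((a - + c) /ℕ s) (+ s) (a≡a%ℕn+[a/ℕn]*n (a - + c) s))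

    -- The shift by 2r keeps the window around x from wrapping around modulo s.
    interior-near : ∀ x y → 2 ℕ.* r ℕ.+ 2 ℕ.* r ℕ.+ 2 ℕ.* r ℕ.≤ (x + + (2 ℕ.* r) - + c) %ℕ s →
      ∣ x - y ∣ ℕ.≤ 2 ℕ.* r → Interior y
    interior-near x y 6r≤q ∣x-y∣≤2r with ∣∣≤⇒bounds (x - y) (2 ℕ.* r) ∣x-y∣≤2r
    ... | x-y≤2r , -2r≤x-y = subst (2 ℕ.* r ℕ.≤_) (sym offset-y) (ℕ.m≤m+n (2 ℕ.* r) k)
      where
      R = + (2 ℕ.* r)
      A = x + R - + c
      q = A %ℕ s
      D = A /ℕ s
      6r≡R+R+R : + (2 ℕ.* r ℕ.+ 2 ℕ.* r ℕ.+ 2 ℕ.* r) ≡ R + R + R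
      6r≡R+R+R = trans (pos-+ (2 ℕ.* r ℕ.+ 2 ℕ.* r) (2 ℕ.* r)) (cong (_+ R) (pos-+ (2 ℕ.* r) (2 ℕ.* r)))
      Q = + q - R + (y - x)
      R≤Q : R ≤ Q
      R≤Q = ≤-by-diff ((+ q - (R + R + R)) + (R - (x - y)))
        (+-mono-≤ (subst (λ z → 0ℤ ≤ + q - z) 6r≡R+R+R (ℕ≤⇒0≤- 6r≤q)) (i≤j⇒0≤j-i x-y≤2r)) (rearrange (+ q) R x y)
        where
        rearrange : ∀ q R x y → q - R + (y - x) - R ≡ (q - (R + R + R)) + (R - (x - y))
        rearrange = solve-∀
      k = proj₁ (≤⇒∃+ R≤Q)
      Q≡R+k : Q ≡ R + + k
      Q≡R+k = proj₂ (≤⇒∃+ R≤Q)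
      y-c≡ : y - + c ≡ + (2 ℕ.* r ℕ.+ k) + D * + s
      y-c≡ = trans (via-x x y R (+ c)) (trans (cong (λ z → z - R + (y - x)) (a≡a%ℕn+[a/ℕn]*n A s))
              (trans (regroup (+ q) D (+ s) R (y - x)) (cong (_+ D * + s) (trans Q≡R+k (sym (pos-+ (2 ℕ.* r) k))))))
        where
        via-x : ∀ x y R c → y - c ≡ (x + R - c) - R + (y - x)
        via-x = solve-∀
        regroup : ∀ q D s R d → q + D * s - R + d ≡ (q - R + d) + D * s
        regroup = solve-∀
      2r+k<s : 2 ℕ.* r ℕ.+ k ℕ.< s
      2r+k<s = drop‿+≤+ (≤-by-diff ((+ s - (1ℤ + + q)) + ((x - y) - - R)) (+-mono-≤ (ℕ≤⇒0≤- (n%ℕd<d A s)) (i≤j⇒0≤j-i -2r≤x-y))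
        (trans (cong (λ z → + s - (1ℤ + z)) (trans (pos-+ (2 ℕ.* r) k) (sym Q≡R+k))) (rearrange (+ s) (+ q) R x y)))
        where
        rearrange : ∀ s q R x y → s - (1ℤ + (q - R + (y - x))) ≡ (s - (1ℤ + q)) + ((x - y) - - R)
        rearrange = solve-∀
      offset-y : offset y ≡ 2 ℕ.* r ℕ.+ k
      offset-y = %ℕ-unique (y - + c) (2 ℕ.* r ℕ.+ k) D 2r+k<s y-c≡

module Plans where
  open import Data.Integer hiding (suc)
  open import Data.Integer.Properties using (+-injective; +-monoʳ-≤; <⇒≱; i≤i+j; +-identityʳ; drop‿+≤+; pos-+)
  open import Data.Integer.Tactic.RingSolver using (solve-∀)
  open import Data.Nat.Tactic.RingSolver using () renaming (solve-∀ to ℕ-solve-∀)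
  open IntegerFacts

  +-cancelˡ : ∀ a {i j} → a + i ≡ a + j → i ≡ j
  +-cancelˡ a {i} {j} eq = trans (isolate a i) (trans (cong (_- a) eq) (sym (isolate a j)))
    where
    isolate : ∀ a i → i ≡ (a + i) - a
    isolate = solve-∀

  +-cancelˡ-≤ : ∀ a {i j} → a + i ≤ a + j → i ≤ j
  +-cancelˡ-≤ a {i} {j} le = subst₂ _≤_ (isolate a i) (isolate a j) (+-monoʳ-≤ (- a) le)
    where
    isolate : ∀ a i → - a + (a + i) ≡ i
    isolate = solve-∀

  pointMass : ℤ → ℕ → ℤ → ℕ
  pointMass b w t = if ⌊ b ≟ t ⌋ then w else 0

  pointMass-≢ : ∀ {b t} w → b ≢ t → pointMass b w t ≡ 0
  pointMass-≢ {b} {t} w b≢t with b ≟ t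
  ... | yes b≡t = ⊥-elim (b≢t b≡t)
  ... | no _ = refl

  pointMass-zero : ∀ b t → pointMass b 0 t ≡ 0
  pointMass-zero b t with b ≟ t
  ... | yes _ = refl
  ... | no _ = refl

  windowSum-cong : ∀ {f g} a N → (∀ t → f t ≡ g t) → windowSum f a N ≡ windowSum g a N
  windowSum-cong a zero f≗g = refl
  windowSum-cong a (suc N) f≗g = cong₂ ℕ._+_ (f≗g (a + + N)) (windowSum-cong a N f≗g)

  windowSum-+ : ∀ f g a N → windowSum (λ t → f t ℕ.+ g t) a N ≡ windowSum f a N ℕ.+ windowSum g a N
  windowSum-+ f g a zero = refl
  windowSum-+ f g a (suc N) rewrite windowSum-+ f g a N =
    interchange (f (a + + N)) (g (a + + N)) (windowSum f a N) (windowSum g a N)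
    where
    interchange : ∀ a b c d → (a ℕ.+ b) ℕ.+ (c ℕ.+ d) ≡ (a ℕ.+ c) ℕ.+ (b ℕ.+ d)
    interchange = ℕ-solve-∀

  windowSum-pointMass-outside : ∀ a i w N → N ℕ.≤ i → windowSum (pointMass (a + + i) w) a N ≡ 0
  windowSum-pointMass-outside a i w zero _ = refl
  windowSum-pointMass-outside a i w (suc N) N<i =
    cong₂ ℕ._+_ (pointMass-≢ w λ eq → ℕ.<⇒≢ N<i (sym (+-injective (+-cancelˡ a eq))))
                (windowSum-pointMass-outside a i w N (ℕ.<⇒≤ N<i))

  windowSum-pointMass-inside : ∀ a i w N → i ℕ.< N → windowSum (pointMass (a + + i) w) a N ≡ w
  windowSum-pointMass-inside a i w (suc N) (s≤s i≤N) with ℕ.m≤n⇒m<n∨m≡n i≤N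
  ... | inj₁ i<N = trans (cong (ℕ._+ windowSum (pointMass (a + + i) w) a N) (pointMass-≢ w λ eq → ℕ.<⇒≢ i<N (+-injective (+-cancelˡ a eq))))
                         (windowSum-pointMass-inside a i w N i<N)
  ... | inj₂ refl = trans (cong₂ ℕ._+_ (pointMass-same (a + + i) w) (windowSum-pointMass-outside a i w i ℕ.≤-refl))
                          (ℕ.+-identityʳ w)
    where
    pointMass-same : ∀ b w → pointMass b w b ≡ w
    pointMass-same b w with b ≟ b
    ... | yes _ = refl
    ... | no b≢b = ⊥-elim (b≢b refl)

  module Counting {X : Set} (τ : X → ℤ) where

    InBlock : ℤ → X → Bool
    InBlock t x = ⌊ τ x ≟ t ⌋

    count : List X → ℤ → ℕ
    count L t = length (filterᵇ (InBlock t) L)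

    count-∷ : ∀ x L t → count (x ∷ L) t ≡ pointMass (τ x) 1 t ℕ.+ count L t
    count-∷ x L t with τ x ≟ t
    ... | yes _ = refl
    ... | no _ = refl

    count-∉ : ∀ L t → (∀ x → x ∈ L → τ x ≢ t) → count L t ≡ 0
    count-∉ [] t _ = refl
    count-∉ (x ∷ L) t h with τ x ≟ t
    ... | yes τx≡t = ⊥-elim (h x (here refl) τx≡t)
    ... | no _ = count-∉ L t λ y y∈ → h y (there y∈)

    InWindow : ℤ → ℕ → List X → Set
    InWindow a N L = ∀ x → x ∈ L → Σ ℕ λ i → i ℕ.< N × τ x ≡ a + + i

    windowSum-count : ∀ a N L → InWindow a N L → windowSum (count L) a N ≡ length L
    windowSum-count a N [] _ = windowSum-zero N
      where
      windowSum-zero : ∀ N → windowSum (λ _ → 0) a N ≡ 0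
      windowSum-zero zero = refl
      windowSum-zero (suc N) = windowSum-zero N
    windowSum-count a N (x ∷ L) win with win x (here refl)
    ... | i , i<N , τx≡ = begin
      windowSum (count (x ∷ L)) a N                                      ≡⟨ windowSum-cong a N (count-∷ x L) ⟩
      windowSum (λ t → pointMass (τ x) 1 t ℕ.+ count L t) a N            ≡⟨ windowSum-+ _ _ a N ⟩
      windowSum (pointMass (τ x) 1) a N ℕ.+ windowSum (count L) a N      ≡⟨ cong₂ ℕ._+_ point rest ⟩
      suc (length L)                                                     ∎
      where
      open ≡-Reasoning
      point : windowSum (pointMass (τ x) 1) a N ≡ 1
      point rewrite τx≡ = windowSum-pointMass-inside a i 1 N i<N
      rest : windowSum (count L) a N ≡ length L
      rest = windowSum-count a N L λ y y∈ → win y (there y∈)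

    sizeBound : List X → ℕ
    sizeBound = Data.List.foldr (λ x b → ∣ τ x ∣ ℕ.+ b) 0

    ∣τ∣≤sizeBound : ∀ L x → x ∈ L → ∣ τ x ∣ ℕ.≤ sizeBound L
    ∣τ∣≤sizeBound (y ∷ L) x (here refl) = ℕ.m≤m+n _ _
    ∣τ∣≤sizeBound (y ∷ L) x (there x∈) = ℕ.≤-trans (∣τ∣≤sizeBound L x x∈) (ℕ.m≤n+m _ _)

    windowStart : List X → ℤ
    windowStart L = - + sizeBound L

    windowLength : List X → ℕ
    windowLength L = suc (sizeBound L ℕ.+ sizeBound L)

    inWindow : ∀ L → InWindow (windowStart L) (windowLength L) L
    inWindow L x x∈ with ∣∣≤⇒bounds (τ x) (sizeBound L) (∣τ∣≤sizeBound L x x∈)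
    ... | τx≤B , -B≤τx with ≤⇒∃+ -B≤τx
    ... | i , τx≡ = i , s≤s (drop‿+≤+ (subst₂ _≤_ shift (pos-+ B B) (+-monoʳ-≤ (+ B) τx≤B))) , τx≡
      where
      B = sizeBound L
      shift : + B + τ x ≡ + i
      shift = trans (cong (λ z → + B + z) τx≡) (cancel (+ B) (+ i))
        where
        cancel : ∀ b i → b + (- b + i) ≡ i
        cancel = solve-∀

    outside-window : ∀ {a N i t} → i ℕ.< N → t ≡ a + + i → t < a ⊎ a + + N ≤ t → ⊥
    outside-window {a} {i = i} i<N refl (inj₁ t<a) = <⇒≱ t<a (i≤i+j a (+ i))
    outside-window {a} i<N refl (inj₂ N≤i) = ℕ.<⇒≱ i<N (drop‿+≤+ (+-cancelˡ-≤ a N≤i))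

    plan : ℕ → List X → ℤ → ℕ
    plan w L t = count L t ℕ.+ pointMass (windowStart L) w t

    plan-isPlan : ∀ w L → IsPlan (length L ℕ.+ w) (plan w L)
    plan-isPlan w L = a , len , vanishes , total
      where
      a = windowStart L
      len = windowLength L
      a≡a+0 : a ≡ a + + 0
      a≡a+0 = sym (+-identityʳ a)
      vanishes : ∀ t → t < a ⊎ a + + len ≤ t → plan w L t ≡ 0
      vanishes t out = cong₂ ℕ._+_
        (count-∉ L t λ x x∈ τx≡t → let (i , i<len , τx≡) = inWindow L x x∈ in outside-window i<len (trans (sym τx≡t) τx≡) out)
        (pointMass-≢ w λ { refl → outside-window (s≤s z≤n) a≡a+0 out })
      total : windowSum (plan w L) a len ≡ length L ℕ.+ w
      total = trans (windowSum-+ (count L) (pointMass a w) a len) (cong₂ ℕ._+_ (windowSum-count a len L (inWindow L))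
        (subst (λ b → windowSum (pointMass b w) a len ≡ w) (sym a≡a+0) (windowSum-pointMass-inside a 0 w len (s≤s z≤n))))

module Expansion {k} (H : Str (Fin k)) (A B : Fin (N H) → Bool) where
  open Semantics H using (sat-cong)

  private
    H⁺ = withCM H A B
    module WH = Walks H
    module WH⁺ = Walks H⁺

  sat-mapU-old : ∀ {m} (φ : Fm (Fin k) m) (ρ : Fin m → Fin (N H)) → sat H⁺ ρ (mapU old φ) ≡ sat H ρ φ
  sat-mapU-old tt ρ = refl
  sat-mapU-old ff ρ = refl
  sat-mapU-old (x ≐ y) ρ = refl
  sat-mapU-old (e x y) ρ = refl
  sat-mapU-old (P u x) ρ = refl
  sat-mapU-old (¬′ φ) ρ = cong not (sat-mapU-old φ ρ)
  sat-mapU-old (φ ∧′ ψ) ρ = cong₂ _∧_ (sat-mapU-old φ ρ) (sat-mapU-old ψ ρ)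
  sat-mapU-old (φ ∨′ ψ) ρ = cong₂ _∨_ (sat-mapU-old φ ρ) (sat-mapU-old ψ ρ)
  sat-mapU-old (φ ⇒′ ψ) ρ = cong₂ _∨_ (cong not (sat-mapU-old φ ρ)) (sat-mapU-old ψ ρ)
  sat-mapU-old (∃′ φ) ρ = any-cong _ _ (λ v → trans (sat-mapU-old φ _) (sat-cong φ λ { zero → refl ; (suc i) → refl })) (verts H)
  sat-mapU-old (∀′ φ) ρ = all-cong _ _ (λ v → trans (sat-mapU-old φ _) (sat-cong φ λ { zero → refl ; (suc i) → refl })) (verts H)

  walk⁺⇒walk : ∀ {j u v} → WH⁺.Walk j u v → WH.Walk j u v
  walk⁺⇒walk WH⁺.done = WH.done
  walk⁺⇒walk (WH⁺.step s d w) = WH.step s d (walk⁺⇒walk w)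

  walk⇒walk⁺ : ∀ {j u v} → WH.Walk j u v → WH⁺.Walk j u v
  walk⇒walk⁺ WH.done = WH⁺.done
  walk⇒walk⁺ (WH.step s d w) = WH⁺.step s d (walk⇒walk⁺ w)

module Locality {k} (G : LInterp k) (λG : Fin (n G) → ℤ) (layering : Layering G λG) where
  open import Data.Nat using (_+_; _≤_)
  import Data.Integer.Properties as ℤ
  open IntegerFacts using (∣-∣-self; ∣-∣-triangle)

  S₀ : Str (Fin k)
  S₀ = asStr G

  V : Set
  V = Fin (n G)

  module SG = Semantics S₀
  module WG = Walks S₀

  gap : V → V → ℕ
  gap u v = ℤ.∣ λG u ℤ.- λG v ∣

  gap-self : ∀ u → gap u u ≡ 0
  gap-self u = ∣-∣-self (λG u)

  gap-sym : ∀ u v → gap u v ≡ gap v u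
  gap-sym u v = ℤ.∣i-j∣≡∣j-i∣ (λG u) (λG v)

  gap-step : ∀ {u v} → WG.Step u v → gap u v ≤ 1
  gap-step {u} (inj₁ refl) rewrite gap-self u = z≤n
  gap-step (inj₂ uv) = layering _ _ uv

  gap-walk : ∀ {j u v} → WG.Walk j u v → gap u v ≤ j
  gap-walk {u = u} WG.done rewrite gap-self u = z≤n
  gap-walk {u = u} {v} (WG.step {b = b} s _ w) =
    ℕ.≤-trans (∣-∣-triangle (λG u) (λG b) (λG v)) (ℕ.+-mono-≤ (gap-step s) (gap-walk w))

  reverseᴳ : ∀ {j u v} → WG.Walk j u v → WG.Walk j v u
  reverseᴳ = WG.reverseWalk (adj-sym G) refl

  module Induced (I : V → Bool) where

    H : Str (Fin k)
    H = induced G I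

    module WH = Walks H

    BallIn : V → ℕ → Set
    BallIn c R = ∀ w → gap c w ≤ R → I w ≡ true

    centre∈ : ∀ {c R} → BallIn c R → I c ≡ true
    centre∈ {c} ball = ball c (ℕ.≤-trans (ℕ.≤-reflexive (gap-self c)) z≤n)

    walkᴴ⇒walkᴳ : ∀ {j u v} → WH.Walk j u v → WG.Walk j u v
    walkᴴ⇒walkᴳ WH.done = WG.done
    walkᴴ⇒walkᴳ (WH.step (inj₁ q) _ w) = WG.step (inj₁ q) refl (walkᴴ⇒walkᴳ w)
    walkᴴ⇒walkᴳ {u = u} (WH.step {b = b} (inj₂ q) _ w) =
      WG.step (inj₂ (∧-true⁻ʳ {I b} (∧-true⁻ʳ {I u} q))) refl (walkᴴ⇒walkᴳ w)

    reverseᴴ : ∀ {j u v} → I u ≡ true → WH.Walk j u v → WH.Walk j v u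
    reverseᴴ = WH.reverseWalk λ u v → adj-sym′ (I u) (I v) (adj-sym G u v)
      where
      adj-sym′ : ∀ a b {x y : Bool} → x ≡ y → a ∧ (b ∧ x) ≡ b ∧ (a ∧ y)
      adj-sym′ false false refl = refl
      adj-sym′ false true refl = refl
      adj-sym′ true false refl = refl
      adj-sym′ true true refl = refl

    walkᴳ⇒walkᴴ : ∀ {c R} → BallIn c R → ∀ {j u v} → WG.Walk j u v → gap c u + j ≤ R → WH.Walk j u v
    walkᴳ⇒walkᴴ ball WG.done _ = WH.done
    walkᴳ⇒walkᴴ {c} {R} ball {suc j} {u} (WG.step {b = b} s _ w) le =
      WH.step (lift s) (ball b (ℕ.m+n≤o⇒m≤o (gap c b) le′)) (walkᴳ⇒walkᴴ ball w le′)
      where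
      gap-b : gap c b ≤ gap c u + 1
      gap-b = ℕ.≤-trans (∣-∣-triangle (λG c) (λG u) (λG b)) (ℕ.+-monoʳ-≤ (gap c u) (gap-step s))
      le′ : gap c b + j ≤ R
      le′ = ℕ.≤-trans (ℕ.+-monoˡ-≤ j gap-b) (ℕ.≤-trans (ℕ.≤-reflexive (ℕ.+-assoc (gap c u) 1 j)) le)
      lift : WG.Step u b → WH.Step u b
      lift (inj₁ q) = inj₁ q
      lift (inj₂ q) = inj₂ (∧-true⁺ (ball u (ℕ.m+n≤o⇒m≤o (gap c u) le)) (∧-true⁺ (ball b (ℕ.m+n≤o⇒m≤o (gap c b) le′)) q))

    walkᴳ⇒walkᴴ-from-centre : ∀ {c R j v} → BallIn c R → WG.Walk j c v → j ≤ R → WH.Walk j c v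
    walkᴳ⇒walkᴴ-from-centre {c} ball w j≤R = walkᴳ⇒walkᴴ ball w (subst (_≤ _) (sym (cong (_+ _) (gap-self c))) j≤R)

    sat-dle-centre : ∀ {m c R} r (x y : Fin m) (ρ : Fin m → V) → BallIn c R → r ≤ R → ρ x ≡ c →
      sat H ρ (dle r x y) ≡ sat S₀ ρ (dle r x y)
    sat-dle-centre r x y ρ ball r≤R refl = ≡true-ext
      (λ p → WG.sat-dle⁺ r x y ρ refl (walkᴴ⇒walkᴳ (WH.sat-dle⁻ r x y ρ p)))
      (λ p → WH.sat-dle⁺ r x y ρ (centre∈ ball) (walkᴳ⇒walkᴴ-from-centre ball (WG.sat-dle⁻ r x y ρ p) r≤R))

    module Guard {m c} r (φ : LFm (Fin k) (suc m)) (ρ : Fin (suc m) → V) (ball : BallIn c r)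
                 (ρc : ρ (fromℕ m) ≡ c) (near : ∀ i → gap c (ρ i) ≤ r)
                 (agree : ∀ ρ′ → ρ′ (fromℕ (suc m)) ≡ c → (∀ i → gap c (ρ′ i) ≤ r) →
                          sat H ρ′ (loc r φ) ≡ sat S₀ ρ′ (loc r φ)) where
      bodyᴳ : V → Bool
      bodyᴳ v = sat S₀ (v ∷ᵥ ρ) (loc r φ)

      guardᴴ guardᴳ : V → Bool
      guardᴴ v = sat H (v ∷ᵥ ρ) (dle r (fromℕ (suc m)) zero)
      guardᴳ v = sat S₀ (v ∷ᵥ ρ) (dle r (fromℕ (suc m)) zero)

      guard-near : ∀ v → guardᴳ v ≡ true → gap c v ≤ r
      guard-near v g = subst (λ z → gap z v ≤ r) ρc (gap-walk (WG.sat-dle⁻ r (fromℕ (suc m)) zero (v ∷ᵥ ρ) g))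

      outside : ∀ v → I v ≡ false → guardᴳ v ≡ false
      outside v Iv = ¬-not λ g → not-¬ (ball v (guard-near v g)) Iv

      guarded : (op : Bool → Bool → Bool) → (∀ a b → op false a ≡ op false b) → ∀ v →
        op (guardᴴ v) (sat H (v ∷ᵥ ρ) (loc r φ)) ≡ op (guardᴳ v) (sat S₀ (v ∷ᵥ ρ) (loc r φ))
      guarded op op-false v
        rewrite sat-dle-centre r (fromℕ (suc m)) zero (v ∷ᵥ ρ) ball ℕ.≤-refl ρc with guardᴳ v in g
      ... | false = op-false _ _
      ... | true = cong (op true) (agree (v ∷ᵥ ρ) ρc λ { zero → guard-near v g ; (suc i) → near i })

    -- The guard d(x,y) ≤ r of a local quantifier confines y to the ball around x, so G[I] and G
    -- agree on an r-local formula as soon as I contains that ball.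
    sat-loc-induced : ∀ {m c} r (φ : LFm (Fin k) m) (ρ : Fin (suc m) → V) → BallIn c r →
      ρ (fromℕ m) ≡ c → (∀ i → gap c (ρ i) ≤ r) → sat H ρ (loc r φ) ≡ sat S₀ ρ (loc r φ)
    sat-loc-induced r tt ρ ball ρc near = refl
    sat-loc-induced r ff ρ ball ρc near = refl
    sat-loc-induced r (x ≐ y) ρ ball ρc near = refl
    sat-loc-induced r (e x y) ρ ball ρc near rewrite ball (ρ x) (near x) | ball (ρ y) (near y) = refl
    sat-loc-induced r (P u x) ρ ball ρc near rewrite ball (ρ x) (near x) = refl
    sat-loc-induced r (¬′ φ) ρ ball ρc near = cong not (sat-loc-induced r φ ρ ball ρc near)
    sat-loc-induced r (φ ∧′ ψ) ρ ball ρc near =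
      cong₂ _∧_ (sat-loc-induced r φ ρ ball ρc near) (sat-loc-induced r ψ ρ ball ρc near)
    sat-loc-induced r (φ ∨′ ψ) ρ ball ρc near =
      cong₂ _∨_ (sat-loc-induced r φ ρ ball ρc near) (sat-loc-induced r ψ ρ ball ρc near)
    sat-loc-induced r (φ ⇒′ ψ) ρ ball ρc near =
      cong₂ _∨_ (cong not (sat-loc-induced r φ ρ ball ρc near)) (sat-loc-induced r ψ ρ ball ρc near)
    sat-loc-induced {m} {c} r (∃≤ φ) ρ ball ρc near = begin
      sat H ρ (∃′ body)                                ≡⟨ Semantics.sat-∃ H body ρ ⟩
      any (λ v → sat H (v ∷ᵥ ρ) body) (verts H)        ≡⟨ any-cong _ _ (guarded _∧_ (λ _ _ → refl)) (verts H) ⟩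
      any (λ v → sat S₀ (v ∷ᵥ ρ) body) (verts H)
        ≡⟨ any-filterᵇ I _ (λ v Iv → cong (_∧ bodyᴳ v) (outside v Iv)) (allFin (n G)) ⟩
      any (λ v → sat S₀ (v ∷ᵥ ρ) body) (allFin (n G))  ≡⟨ sym (any-filterᵇ (λ _ → true) _ (λ _ ()) (allFin (n G))) ⟩
      any (λ v → sat S₀ (v ∷ᵥ ρ) body) (verts S₀)      ≡⟨ sym (Semantics.sat-∃ S₀ body ρ) ⟩
      sat S₀ ρ (∃′ body)                               ∎
      where
      open ≡-Reasoning
      open Guard r φ ρ ball ρc near (λ ρ′ → sat-loc-induced r φ ρ′ ball)
      body = dle r (fromℕ (suc m)) zero ∧′ loc r φ
    sat-loc-induced {m} {c} r (∀≤ φ) ρ ball ρc near = begin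
      sat H ρ (∀′ body)                                ≡⟨ Semantics.sat-∀ H body ρ ⟩
      all (λ v → sat H (v ∷ᵥ ρ) body) (verts H)        ≡⟨ all-cong _ _ (guarded (λ a b → not a ∨ b) (λ _ _ → refl)) (verts H) ⟩
      all (λ v → sat S₀ (v ∷ᵥ ρ) body) (verts H)
        ≡⟨ all-filterᵇ I _ (λ v Iv → cong (λ a → not a ∨ bodyᴳ v) (outside v Iv)) (allFin (n G)) ⟩
      all (λ v → sat S₀ (v ∷ᵥ ρ) body) (allFin (n G))  ≡⟨ sym (all-filterᵇ (λ _ → true) _ (λ _ ()) (allFin (n G))) ⟩
      all (λ v → sat S₀ (v ∷ᵥ ρ) body) (verts S₀)      ≡⟨ sym (Semantics.sat-∀ S₀ body ρ) ⟩
      sat S₀ ρ (∀′ body)                               ∎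
      where
      open ≡-Reasoning
      open Guard r φ ρ ball ρc near (λ ρ′ → sat-loc-induced r φ ρ′ ball)
      body = dle r (fromℕ (suc m)) zero ⇒′ loc r φ

    walkᴳ⇒walkᴴ-between : ∀ {x y R} → BallIn x R → BallIn y R → WG.Walk (2 ℕ.* R) x y → WH.Walk (2 ℕ.* R) x y
    walkᴳ⇒walkᴴ-between {R = R} ball-x ball-y w with WG.splitWalk R w
    ... | b , x→b , b→y = walkᴳ⇒walkᴴ-from-centre ball-x x→b ℕ.≤-refl WH.++ʷ
        reverseᴴ (centre∈ ball-y) (walkᴳ⇒walkᴴ-from-centre ball-y (reverseᴳ b→y) (ℕ.≤-reflexive (ℕ.+-identityʳ R)))

basic : ∀ {U} → Kind → ℕ → ℕ → LFm U 0 → Basic U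
basic κ m r ψ = record { kind = κ ; spread = m ; range = r ; core = ψ }

module Setting {k} (G : LInterp k) (λG : Fin (n G) → ℤ) (layering : Layering G λG)
               (ψ : LFm (Fin k) 0) (r′ r ℓ : ℕ) (r′≤r : r′ ℕ.≤ r) (2r<ℓ : 2 ℕ.* r ℕ.< ℓ) where
  open Locality G λG layering public
  open Covers r ℓ 2r<ℓ public

  Apart : V → V → Set
  Apart u v = ¬ WG.Walk (2 ℕ.* r′) u v

  Core : V → Set
  Core v = sat S₀ (λ _ → v) (loc r′ ψ) ≡ true

  close? : V → V → Bool
  close? u v = sat S₀ (u ∷ᵥ v ∷ᵥ []ᵥ) (dle (2 ℕ.* r′) zero (suc zero))

  close?-true⁻ : ∀ {u v} → close? u v ≡ true → WG.Walk (2 ℕ.* r′) u v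
  close?-true⁻ {u} {v} = WG.sat-dle⁻ (2 ℕ.* r′) zero (suc zero) (u ∷ᵥ v ∷ᵥ []ᵥ)

  close?-false⁻ : ∀ {u v} → close? u v ≡ false → Apart u v
  close?-false⁻ {u} {v} far w = not-¬ (WG.sat-dle⁺ (2 ℕ.* r′) zero (suc zero) (u ∷ᵥ v ∷ᵥ []ᵥ) refl w) far

  apart? : ∀ u v → Dec (Apart u v)
  apart? u v with close? u v in c
  ... | true = no λ apart → apart (close?-true⁻ c)
  ... | false = yes (close?-false⁻ c)

  module Interval (c : ℕ) (t : ℤ) where
    open Cover c

    I C-set M-set : V → Bool
    I = pre λG (ivl ℓ r c t)
    C-set = pre λG (Md ℓ (2 ℕ.* r) (ivl ℓ r c t))
    M-set = pre λG (Md ℓ r (ivl ℓ r c t))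

    open Induced I public
    open Expansion H C-set M-set public

    Gₜ : Str (Ext (Fin k))
    Gₜ = withCM H C-set M-set

    module WT = Walks Gₜ

    ball-inside : ∀ {d v} → Inside d t (λG v) → r′ ℕ.≤ d → BallIn v r′
    ball-inside {d} {v} ins r′≤d w gap≤ = Inside-ivl {t} (Inside-ball {d} {r′} {t} {λG v} (λG w) ins gap≤ r′≤d)

    sat-core-local : ∀ {K} (ρ : Fin (K ℕ.+ 0) → V) (i : Fin K) → BallIn (ρ (xv i)) r′ →
      sat Gₜ ρ (mapU old (coreAt r′ ψ i)) ≡ sat S₀ (λ _ → ρ (xv i)) (loc r′ ψ)
    sat-core-local ρ i ball = begin
      sat Gₜ ρ (mapU old (coreAt r′ ψ i))             ≡⟨ sat-mapU-old (coreAt r′ ψ i) ρ ⟩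
      sat H ρ (coreAt r′ ψ i)                        ≡⟨ Semantics.sat-coreAt H r′ ψ i ρ ⟩
      sat H (λ _ → ρ (xv i)) (loc r′ ψ)              ≡⟨ sat-loc-induced r′ ψ (λ _ → ρ (xv i)) ball refl near ⟩
      sat S₀ (λ _ → ρ (xv i)) (loc r′ ψ)             ∎
      where
      open ≡-Reasoning
      near : ∀ (j : Fin 1) → gap (ρ (xv i)) (ρ (xv i)) ℕ.≤ r′
      near _ = subst (ℕ._≤ r′) (sym (gap-self (ρ (xv i)))) z≤n

    close⇒walkᴳ : ∀ {K} (ρ : Fin K → V) a b → sat Gₜ ρ (dle (2 ℕ.* r′) a b) ≡ true →
      WG.Walk (2 ℕ.* r′) (ρ a) (ρ b)
    close⇒walkᴳ ρ a b p = walkᴴ⇒walkᴳ (walk⁺⇒walk (WT.sat-dle⁻ (2 ℕ.* r′) a b ρ p))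

    walkᴳ⇒close : ∀ {K} (ρ : Fin K → V) a b → BallIn (ρ a) r′ → BallIn (ρ b) r′ →
      WG.Walk (2 ℕ.* r′) (ρ a) (ρ b) → sat Gₜ ρ (dle (2 ℕ.* r′) a b) ≡ true
    walkᴳ⇒close ρ a b ball-a ball-b w =
      WT.sat-dle⁺ (2 ℕ.* r′) a b ρ (centre∈ ball-a) (walk⇒walk⁺ (walkᴳ⇒walkᴴ-between ball-a ball-b w))

  HasPlan : Basic (Fin k) → ℕ → Set
  HasPlan φ c = Σ (ℤ → ℕ) λ p → IsPlan (spread φ) p × ((t : ℤ) → Interval.Gₜ c t ⊨ variant φ (p t))

module ExistentialCase {k} (G : LInterp k) (λG : Fin (n G) → ℤ) (layering : Layering G λG)
    (m r′ : ℕ) (ψ : LFm (Fin k) 0) (r ℓ : ℕ) (r′≤r : r′ ℕ.≤ r) (2r<ℓ : 2 ℕ.* r ℕ.< ℓ)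
    (G⊨φ : asStr G ⊨ sentence (basic existential m r′ ψ)) where
  open import Data.Nat using (_+_; _*_; _≤_; _<_; _∸_)
  open import Data.Nat.Tactic.RingSolver using (solve-∀)
  open Setting G λG layering ψ r′ r ℓ r′≤r 2r<ℓ

  φ∃ : Basic (Fin k)
  φ∃ = basic existential m r′ ψ

  private
    matrix : Fm (Fin k) (m + 0)
    matrix = farApart m r′ ∧′ ⋀ (map (coreAt r′ ψ) (allFin m))

    model = SG.sat-exN⁻ m matrix []ᵥ (trans (SG.sat-cong (exN m matrix) (λ ())) G⊨φ)
    env = proj₁ model ++ᵉ []ᵥ
    env⊨matrix : sat S₀ env matrix ≡ true
    env⊨matrix = proj₂ (proj₂ model)

  witness : Fin m → V
  witness i = env (xv i)

  witnesses-apart : ∀ i j → toℕ i < toℕ j → Apart (witness i) (witness j)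
  witnesses-apart i j i<j w =
    not-¬ (WG.sat-dle⁺ (2 * r′) (xv i) (xv j) env refl w) (SG.sat-farApart⁻ {m} {r′} env (∧-true⁻ˡ env⊨matrix) i j i<j)

  witnesses-core : ∀ i → Core (witness i)
  witnesses-core i = trans (sym (SG.sat-coreAt r′ ψ i env))
    (SG.sat-⋀⁻ (coreAt r′ ψ) (allFin m) env (∧-true⁻ʳ {sat S₀ env (farApart m r′)} env⊨matrix) (∈-allFin i))

  witnesses : List V
  witnesses = tabulate witness

  witnesses-apart-all : AllPairs Apart witnesses
  witnesses-apart-all = AllPairs.tabulate⁺-< λ {i} {j} → witnesses-apart i j

  witnesses-core-all : All Core witnesses
  witnesses-core-all = All.tabulate⁺ witnesses-core

  exceptions : List ℕ
  exceptions = concatMap (λ v → forbiddenCovers (λG v) (2 * r)) witnesses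

  exceptions-length : length exceptions ≤ 6 * r * m
  exceptions-length = begin
    length exceptions    ≡⟨ length-concatMap-const _ (2 * r) (λ v → length-forbiddenCovers (λG v) (2 * r)) witnesses ⟩
    length witnesses * (2 * r)  ≡⟨ cong (_* (2 * r)) (length-tabulate witness) ⟩
    m * (2 * r)          ≤⟨ ℕ.m≤m+n (m * (2 * r)) (4 * r * m) ⟩
    m * (2 * r) + 4 * r * m  ≡⟨ regroup r m ⟩
    6 * r * m            ∎
    where
    open ℕ.≤-Reasoning
    regroup : ∀ r m → m * (2 * r) + 4 * r * m ≡ 6 * r * m
    regroup = solve-∀

  module _ (c : ℕ) (c<s : c < ℓ ∸ 2 * r) (c∉ : c ∉ exceptions) where
    open Cover c
    open Plans.Counting (λ v → block (λG v))

    interior : ∀ {v} → v ∈ witnesses → Interior (λG v)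
    interior {v} v∈ = allowed-offset (λG v) (2 * r) c<s (λ c∈ → c∉ (∈-concatMap⁺ _ (Any.map (λ { refl → c∈ }) v∈)))

    inBlock : ℤ → List V
    inBlock t = filterᵇ (InBlock t) witnesses

    plan-inBlock : ∀ t → plan 0 witnesses t ≡ length (inBlock t)
    plan-inBlock t = trans (cong (λ z → count witnesses t + z) (Plans.pointMass-zero _ t)) (ℕ.+-identityʳ _)

    witnesses-plan : IsPlan m (plan 0 witnesses)
    witnesses-plan = subst (λ z → IsPlan z (plan 0 witnesses))
      (trans (ℕ.+-identityʳ _) (length-tabulate witness)) (plan-isPlan 0 witnesses)

    Gₜ⊨variant : ∀ t → Interval.Gₜ c t ⊨ variant φ∃ (length (inBlock t))
    Gₜ⊨variant t = sat-exN⁺ K _ (λ ()) σ (λ j → I-holds (∈-lookup (opposite j))) (∧-true⁺ far cores)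
      where
      open Interval c t
      open Semantics Gₜ using (sat-exN⁺; sat-farApart⁺; sat-⋀⁺)
      Lt = inBlock t
      K = length Lt
      σ : Fin K → V
      σ j = lookup Lt (opposite j)
      ρ = σ ++ᵉ (λ ())
      ρ-xv : ∀ i → ρ (xv i) ≡ lookup Lt i
      ρ-xv i = trans (++ᵉ-xv σ (λ ()) i) (cong (lookup Lt) (opposite-involutive i))
      deep : ∀ {v} → v ∈ Lt → Inside (2 * r) t (λG v)
      deep {v} v∈ with ∈-filterᵇ⁻ (InBlock t) witnesses v∈
      ... | v∈w , in-t =
        subst (λ t′ → Inside (2 * r) t′ (λG v)) (⌊⌋-true⁻ (block (λG v) ℤ.≟ t) in-t) (interior-Inside (interior v∈w))
      I-holds : ∀ {v} → v ∈ Lt → I v ≡ true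
      I-holds v∈ = Inside-ivl (Inside-self (deep v∈))
      far : sat Gₜ ρ (farApart K r′) ≡ true
      far = sat-farApart⁺ {K} {r′} ρ λ i j i<j → ¬-not λ close →
        AllPairs-lookup (AllPairs.filter⁺ (T? ∘ InBlock t) witnesses-apart-all) i j i<j
          (subst₂ (WG.Walk (2 * r′)) (ρ-xv i) (ρ-xv j) (close⇒walkᴳ ρ (xv i) (xv j) close))
      cores : sat Gₜ ρ (⋀ (map (λ i → P C (xv i) ∧′ mapU old (coreAt r′ ψ i)) (allFin K))) ≡ true
      cores = sat-⋀⁺ _ (allFin K) ρ λ i _ → ∧-true⁺ (in-C i) (core-holds i)
        where
        in-C : ∀ i → sat Gₜ ρ (P C (xv i)) ≡ true
        in-C i rewrite ρ-xv i = ∧-true⁺ (I-holds (∈-lookup i)) (Inside-Md⁺ (deep (∈-lookup i)))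
        r′≤2r : r′ ≤ 2 * r
        r′≤2r = ℕ.≤-trans r′≤r (ℕ.m≤m+n r (r + 0))
        core-holds : ∀ i → sat Gₜ ρ (mapU old (coreAt r′ ψ i)) ≡ true
        core-holds i = trans (sat-core-local ρ i (subst (λ v → BallIn v r′) (sym (ρ-xv i)) (ball-inside (deep (∈-lookup i)) r′≤2r)))
          (trans (cong (λ v → sat S₀ (λ _ → v) (loc r′ ψ)) (ρ-xv i))
            (All.lookup (All.filter⁺ (T? ∘ InBlock t) witnesses-core-all) (∈-lookup i)))

    hasPlan : HasPlan φ∃ c
    hasPlan = plan 0 witnesses , witnesses-plan ,
      λ t → subst (λ K → Interval.Gₜ c t ⊨ variant φ∃ K) (sym (plan-inBlock t)) (Gₜ⊨variant t)

module UniversalCase {k} (G : LInterp k) (λG : Fin (n G) → ℤ) (layering : Layering G λG)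
    (m r′ : ℕ) (ψ : LFm (Fin k) 0) (r ℓ : ℕ) (r′≤r : r′ ℕ.≤ r) (2r<ℓ : 2 ℕ.* r ℕ.< ℓ)
    (G⊨φ : asStr G ⊨ sentence (basic universal m r′ ψ)) where
  open import Data.Nat using (_+_; _*_; _≤_; _<_; _∸_)
  open import Data.Nat.Tactic.RingSolver using (solve-∀)
  open Setting G λG layering ψ r′ r ℓ r′≤r 2r<ℓ

  φ∀ : Basic (Fin k)
  φ∀ = basic universal m r′ ψ

  Fails : V → Set
  Fails v = sat S₀ (λ _ → v) (loc r′ ψ) ≡ false

  Scattered : List V → Set
  Scattered Y = AllPairs Apart Y × All Fails Y

  scattered? : ∀ Y → Dec (Scattered Y)
  scattered? Y = allPairs? apart? Y ×-dec All.all? (λ v → sat S₀ (λ _ → v) (loc r′ ψ) Data.Bool.≟ false) Y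

  module TooLarge (Y : List V) (scattered : Scattered Y) (m<Y : suc m ≤ length Y) where
    private
      matrix : Fm (Fin k) (suc m + 0)
      matrix = farApart (suc m) r′ ⇒′ ⋁ (map (coreAt r′ ψ) (allFin (suc m)))

      y : Fin (suc m) → V
      y i = lookup Y (inject≤ i m<Y)

      σ : Fin (suc m) → V
      σ j = y (opposite j)

      ρ = σ ++ᵉ []ᵥ

      ρ-xv : ∀ i → ρ (xv i) ≡ y i
      ρ-xv i = trans (++ᵉ-xv σ []ᵥ i) (cong y (opposite-involutive i))

      G⊨matrix : sat S₀ ρ matrix ≡ true
      G⊨matrix = SG.sat-allN⁻ (suc m) matrix []ᵥ (trans (SG.sat-cong (allN (suc m) matrix) (λ ())) G⊨φ) σ (λ _ → refl)

      far : sat S₀ ρ (farApart (suc m) r′) ≡ true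
      far = SG.sat-farApart⁺ {suc m} {r′} ρ λ i j i<j → ¬-not λ close →
        AllPairs-lookup (proj₁ scattered) (inject≤ i m<Y) (inject≤ j m<Y)
          (subst₂ ℕ._<_ (sym (toℕ-inject≤ i m<Y)) (sym (toℕ-inject≤ j m<Y)) i<j)
          (subst₂ (WG.Walk (2 * r′)) (ρ-xv i) (ρ-xv j) (WG.sat-dle⁻ (2 * r′) (xv i) (xv j) ρ close))

      fails : ∀ i → sat S₀ ρ (coreAt r′ ψ i) ≡ false
      fails i = trans (SG.sat-coreAt r′ ψ i ρ)
        (trans (cong (λ v → sat S₀ (λ _ → v) (loc r′ ψ)) (ρ-xv i)) (All.lookup (proj₂ scattered) (∈-lookup (inject≤ i m<Y))))

    contradiction : ⊥
    contradiction with ∨-true⁻ G⊨matrix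
    ... | inj₁ not-far = not-¬ far (not-true⁻ not-far)
    ... | inj₂ some-core with SG.sat-⋁⁻ (coreAt r′ ψ) (allFin (suc m)) ρ some-core
    ... | i , _ , holds = not-¬ holds (fails i)

  scattered-length : ∀ Y → Scattered Y → length Y ≤ m
  scattered-length Y scattered with suc m ℕ.≤? length Y
  ... | no m≮Y = ℕ.≤-pred (ℕ.≰⇒> m≮Y)
  ... | yes m<Y = ⊥-elim (TooLarge.contradiction Y scattered m<Y)

  private
    maximum = Longest.longest (allFin (n G)) ∈-allFin scattered? ([] , []) m

  X : List V
  X = proj₁ maximum

  X-scattered : Scattered X
  X-scattered = proj₁ (proj₂ maximum)

  X-length : length X ≤ m
  X-length = proj₁ (proj₂ (proj₂ maximum))

  X-longest : ∀ Y → Scattered Y → length Y ≤ length X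
  X-longest Y sY = proj₂ (proj₂ (proj₂ maximum)) Y sY (scattered-length Y sY)

  exceptions : List ℕ
  exceptions = concatMap (λ v → forbiddenCovers (λG v ℤ.+ + (2 * r)) (2 * r + 2 * r + 2 * r)) X

  exceptions-length : length exceptions ≤ 6 * r * m
  exceptions-length = begin
    length exceptions                       ≡⟨ length-concatMap-const _ (2 * r + 2 * r + 2 * r)
                                                 (λ v → length-forbiddenCovers (λG v ℤ.+ + (2 * r)) _) X ⟩
    length X * (2 * r + 2 * r + 2 * r)      ≤⟨ ℕ.*-monoˡ-≤ (2 * r + 2 * r + 2 * r) X-length ⟩
    m * (2 * r + 2 * r + 2 * r)             ≡⟨ regroup r m ⟩
    6 * r * m                               ∎
    where
    open ℕ.≤-Reasoning
    regroup : ∀ r m → m * (2 * r + 2 * r + 2 * r) ≡ 6 * r * m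
    regroup = solve-∀

  module _ (c : ℕ) (c<s : c < ℓ ∸ 2 * r) (c∉ : c ∉ exceptions) where
    open Cover c
    open Plans.Counting (λ v → block (λG v))

    2r′≤2r : 2 * r′ ≤ 2 * r
    2r′≤2r = ℕ.*-monoʳ-≤ 2 r′≤r

    -- A failing vertex far from all of X would extend X; so it is close to an allowed anchor.
    failing-interior : ∀ {y} → Fails y → Interior (λG y)
    failing-interior {y} fails-y with any (close? y) X in near
    ... | true with any-true⁻ (close? y) X near
    ... | x , x∈ , close = interior-near (λG x) (λG y)
          (allowed-offset (λG x ℤ.+ + (2 * r)) _ c<s (λ c∈ → c∉ (∈-concatMap⁺ _ (Any.map (λ { refl → c∈ }) x∈))))
          (subst (_≤ 2 * r) (gap-sym y x) (ℕ.≤-trans (gap-walk (close?-true⁻ close)) 2r′≤2r))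
    failing-interior {y} fails-y | false =
      ⊥-elim (ℕ.<-irrefl refl (X-longest (y ∷ X) (apart-from-X ∷ proj₁ X-scattered , fails-y ∷ proj₂ X-scattered)))
      where
      apart-from-X : All (Apart y) X
      apart-from-X = All.tabulate λ x∈ → close?-false⁻ (any-false⁻ (close? y) X near x∈)

    apart-across-blocks : ∀ {x y} → Fails x → Fails y → block (λG x) ≢ block (λG y) → Apart x y
    apart-across-blocks {x} {y} fails-x fails-y x≢y w =
      x≢y (sym (interior-close-block {λG x} {λG y} (failing-interior fails-x) (failing-interior fails-y) (ℕ.≤-trans (gap-walk w) 2r′≤2r)))

    -- Replacing the part of X in block t by Y keeps it scattered, so Y is no longer than that part.
    exchange : ∀ t Y → Scattered Y → (∀ {y} → y ∈ Y → block (λG y) ≡ t) → length Y ≤ count X t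
    exchange t Y (apart-Y , fails-Y) in-t = ℕ.+-cancelˡ-≤ (length X-out) (length Y) (count X t) (begin
      length X-out + length Y      ≡⟨ sym (length-++ X-out) ⟩
      length (X-out ++ Y)          ≤⟨ X-longest (X-out ++ Y) scattered ⟩
      length X                     ≡⟨ sym (length-filterᵇ-not (InBlock t) X) ⟩
      count X t + length X-out     ≡⟨ ℕ.+-comm (count X t) (length X-out) ⟩
      length X-out + count X t     ∎)
      where
      open ℕ.≤-Reasoning
      outside : V → Bool
      outside v = not (InBlock t v)
      X-out = filterᵇ outside X
      fails-X-out : All Fails X-out
      fails-X-out = All.filter⁺ (T? ∘ outside) (proj₂ X-scattered)
      cross : All (λ x → All (Apart x) Y) X-out
      cross = All.tabulate λ {x} x∈ → All.tabulate λ {y} y∈ →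
        apart-across-blocks (All.lookup fails-X-out x∈) (All.lookup fails-Y y∈) λ same →
          ⌊⌋-false⁻ (block (λG x) ℤ.≟ t) (not-true⁻ (proj₂ (∈-filterᵇ⁻ outside X x∈))) (trans same (in-t y∈))
      scattered : Scattered (X-out ++ Y)
      scattered = AllPairs.++⁺ (AllPairs.filter⁺ (T? ∘ outside) (proj₁ X-scattered)) apart-Y cross ,
                  All.++⁺ fails-X-out fails-Y

    Gₜ⊨variant : ∀ t K → count X t ≤ K → Interval.Gₜ c t ⊨ variant φ∀ K
    Gₜ⊨variant t K count≤K = sat-allN⁺ (suc K) _ (λ ()) λ σ _ → holds σ
      where
      open Interval c t
      open Semantics Gₜ using (sat-allN⁺; sat-⋀⁻; sat-farApart⁻; sat-⋁-false⁻)
      in-M : Fm (Ext (Fin k)) (suc K + 0)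
      in-M = ⋀ (map (λ i → P M (xv i)) (allFin (suc K)))
      cores : Fm (Ext (Fin k)) (suc K + 0)
      cores = ⋁ (map (λ i → mapU old (coreAt r′ ψ i)) (allFin (suc K)))
      refute : ∀ ρ → sat Gₜ ρ cores ≡ false → sat Gₜ ρ (in-M ∧′ farApart (suc K) r′) ≡ true → ⊥
      refute ρ no-core premise = ℕ.<⇒≱ (ℕ.s≤s count≤K) (begin
        suc K            ≡⟨ sym (length-tabulate u) ⟩
        length Y         ≤⟨ exchange t Y ((AllPairs.tabulate⁺-< λ {i} {j} → apart i j) , All.tabulate⁺ fails) in-t ⟩
        count X t        ∎)
        where
        open ℕ.≤-Reasoning
        u : Fin (suc K) → V
        u i = ρ (xv i)
        Y = tabulate u
        deep : ∀ i → Inside r t (λG (u i))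
        deep i = Inside-Md⁻ (∧-true⁻ʳ {dom Gₜ (u i)} (sat-⋀⁻ (λ i → P M (xv i)) (allFin (suc K)) ρ (∧-true⁻ˡ premise) (∈-allFin i)))
        ball : ∀ i → BallIn (u i) r′
        ball i = ball-inside (deep i) r′≤r
        fails : ∀ i → Fails (u i)
        fails i = trans (sym (sat-core-local ρ i (ball i))) (sat-⋁-false⁻ _ (allFin (suc K)) ρ no-core (∈-allFin i))
        apart : ∀ i j → toℕ i < toℕ j → Apart (u i) (u j)
        apart i j i<j w = not-¬ (walkᴳ⇒close ρ (xv i) (xv j) (ball i) (ball j) w)
          (sat-farApart⁻ {suc K} {r′} ρ (∧-true⁻ʳ {sat Gₜ ρ in-M} premise) i j i<j)
        in-t : ∀ {y} → y ∈ Y → block (λG y) ≡ t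
        in-t y∈ with ∈-tabulate⁻ {f = u} y∈
        ... | i , refl = interior-block (failing-interior (fails i)) (Inside-self (deep i))
      holds : (σ : Fin (suc K) → V) → sat Gₜ (σ ++ᵉ (λ ())) ((in-M ∧′ farApart (suc K) r′) ⇒′ cores) ≡ true
      holds σ with sat Gₜ (σ ++ᵉ (λ ())) cores in concl
      ... | true = ∨-true⁺ʳ {not (sat Gₜ (σ ++ᵉ (λ ())) (in-M ∧′ farApart (suc K) r′))} concl
      ... | false = ∨-true⁺ˡ (not-true⁺ (¬-not (refute (σ ++ᵉ (λ ())) concl)))

    hasPlan : HasPlan φ∀ c
    hasPlan = plan (m ∸ length X) X ,
      subst (λ z → IsPlan z (plan (m ∸ length X) X)) (ℕ.m+[n∸m]≡n X-length) (plan-isPlan (m ∸ length X) X) ,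
      λ t → Gₜ⊨variant t _ (ℕ.m≤m+n (count X t) _)

open import Data.Nat using (_≤_; _<_; _*_; _+_; _∸_)

2r<ℓ⇐2r[3m+1]<ℓ : ∀ r m ℓ → 2 * r * (3 * m + 1) < ℓ → 2 * r < ℓ
2r<ℓ⇐2r[3m+1]<ℓ r m ℓ ℓ-large = ℕ.≤-<-trans
  (subst (_≤ 2 * r * (3 * m + 1)) (ℕ.*-identityʳ (2 * r)) (ℕ.*-monoʳ-≤ (2 * r) (ℕ.m≤n+m 1 (3 * m)))) ℓ-large

lemma17 : {k : ℕ} (φ : Basic (Fin k)) (G : LInterp k) →
    asStr G ⊨ sentence φ →
    (λG : Fin (n G) → ℤ) → Layering G λG →
    (r ℓ : ℕ) → range φ ≤ r → 2 * r * (3 * spread φ + 1) < ℓ →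
    Σ (List ℕ) λ exceptions → length exceptions ≤ 6 * r * spread φ ×
      ((c : ℕ) → c < ℓ ∸ 2 * r → c ∉ exceptions →
        Σ (ℤ → ℕ) λ p → IsPlan (spread φ) p ×
          ((t : ℤ) →
            withCM (induced G (pre λG (ivl ℓ r c t)))
                   (pre λG (Md ℓ (2 * r) (ivl ℓ r c t)))
                   (pre λG (Md ℓ r (ivl ℓ r c t)))
              ⊨ variant φ (p t)))
lemma17 record { kind = existential ; spread = m ; range = r′ ; core = ψ } G G⊨φ λG layering r ℓ r′≤r ℓ-large =
  exceptions , exceptions-length , hasPlan
  where open ExistentialCase G λG layering m r′ ψ r ℓ r′≤r (2r<ℓ⇐2r[3m+1]<ℓ r m ℓ ℓ-large) G⊨φ
lemma17 record { kind = universal ; spread = m ; range = r′ ; core = ψ } G G⊨φ λG layering r ℓ r′≤r ℓ-large =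
  exceptions , exceptions-length , hasPlan
  where open UniversalCase G λG layering m r′ ψ r ℓ r′≤r (2r<ℓ⇐2r[3m+1]<ℓ r m ℓ ℓ-large) G⊨φ
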